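{- Let $G=(V,E)$ be a finite, undirected, unweighted, 2-vertex-connected graph with $n=|V|$ vertices, let $T$ be a minimum spanning tree of $G$ (in an unweighted graph, any spanning tree), and let $\gamma$ be a real number with $0\le\gamma<3$. Suppose $C_T$ is a closed walk in $G$ (vertices may repeat) that visits every vertex having odd degree in $T$ and satisfies $\ell(C_T)\le(1+\gamma)|C_T|$. Then one can construct a TSP tour of $G$ of length at most $\frac{4n}{3-\gamma}$.
   Context: For a closed walk $C$ in $G$, $|C|$ denotes the number of distinct vertices visited by $C$, and $\ell(C)$ denotes its length, i.e. the number of edges traversed counted with multiplicity. A TSP tour of $G$ is a closed walk visiting every vertex of $V$ at least once; its length is its number of traversed edges counted with multiplicity.
   Formalization: The parameter γ is rational rather than real. -}

module Defs where

open import Data.Nat using (ℕ; _≤_; _%_)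
open import Data.Fin using (Fin; _≟_)
open import Data.Bool using (Bool; true; false; if_then_else_)
open import Data.List using (List; []; _∷_; length; map; allFin; deduplicate; last; head)
open import Data.Nat.ListAction using (sum)
open import Data.List.Relation.Unary.Linked using (Linked)
open import Data.List.Relation.Unary.All using (All)
open import Data.List.Relation.Unary.Unique.Propositional using (Unique)
open import Data.List.Membership.Propositional using (_∈_)
open import Data.Maybe using (just)
open import Data.Product using (Σ; _×_; _,_)
open import Data.Integer using (+_)
open import Data.Rational using (ℚ; _/_)
open import Relation.Binary.PropositionalEquality using (_≡_; _≢_)
open import Relation.Nullary using (¬_)

record Graph (n : ℕ) : Set where
  field
    adj    : Fin n → Fin n → Bool
    sym    : ∀ u v → adj u v ≡ adj v u
    irrefl : ∀ v → adj v v ≡ false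

open Graph public

Adj : ∀ {n} → Graph n → Fin n → Fin n → Set
Adj G u v = adj G u v ≡ true

record Walk {n : ℕ} (G : Graph n) (u v : Fin n) : Set where
  field
    rest   : List (Fin n)
    linked : Linked (Adj G) (u ∷ rest)
    ends   : last (u ∷ rest) ≡ just v

open Walk public

verts : ∀ {n} {G : Graph n} {u v : Fin n} → Walk G u v → List (Fin n)
verts {u = u} w = u ∷ rest w

ClosedWalk : ∀ {n} → Graph n → Set
ClosedWalk {n} G = Σ (Fin n) (λ u → Walk G u u)

len : ∀ {n} {G : Graph n} → ClosedWalk G → ℕ
len (u , w) = length (rest w)

cwVerts : ∀ {n} {G : Graph n} → ClosedWalk G → List (Fin n)
cwVerts (u , w) = verts w

numDistinct : ∀ {n} {G : Graph n} → ClosedWalk G → ℕ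
numDistinct C = length (deduplicate _≟_ (cwVerts C))

Visits : ∀ {n} {G : Graph n} → ClosedWalk G → Fin n → Set
Visits C v = v ∈ cwVerts C

IsTSPTour : ∀ {n} {G : Graph n} → ClosedWalk G → Set
IsTSPTour {n} C = ∀ (v : Fin n) → Visits C v

Connected : ∀ {n} → Graph n → Set
Connected {n} G = ∀ (u v : Fin n) → Walk G u v

TwoVertexConnected : ∀ {n} → Graph n → Set
TwoVertexConnected {n} G =
  3 ≤ n × Connected G ×
  (∀ (x u v : Fin n) → u ≢ x → v ≢ x →
     Σ (Walk G u v) (λ w → All (_≢ x) (verts w)))

record Cycle {n : ℕ} (G : Graph n) : Set where
  field
    cverts   : List (Fin n)
    long     : 3 ≤ length cverts
    distinct : Unique cverts
    clinked  : Linked (Adj G) cverts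
    closing  : ∀ a b → head cverts ≡ just a → last cverts ≡ just b → Adj G b a

Acyclic : ∀ {n} → Graph n → Set
Acyclic G = ¬ Cycle G

Subgraph : ∀ {n} → Graph n → Graph n → Set
Subgraph {n} T G = ∀ (u v : Fin n) → Adj T u v → Adj G u v

IsSpanningTree : ∀ {n} → Graph n → Graph n → Set
IsSpanningTree G T = Subgraph T G × Connected T × Acyclic T

degree : ∀ {n} → Graph n → Fin n → ℕ
degree {n} G v = sum (map (λ w → if adj G v w then 1 else 0) (allFin n))

OddDegree : ∀ {n} → Graph n → Fin n → Set
OddDegree G v = degree G v % 2 ≡ 1

toℚ : ℕ → ℚ
toℚ k = (+ k) / 1

module Submission where

-- Three closed walks through all vertices are built.  Cutting C at the first visits of the
-- odd-degree vertices of T and keeping every other piece gives a T-join J with |J| ≤ ℓ(C)/2,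
-- and peeling the leaves of T off one by one turns T ∪ J into a tour of length
-- ≤ n − 1 + |J|.  Adding a there-and-back detour to C for every vertex it misses gives a
-- tour of length ℓ(C) + 2(n − |C|), and doing the same starting from a single vertex one of
-- length ≤ 2n.  For γ ≥ 1 the last tour suffices since 3 − γ ≤ 2.  For γ ≤ 1 the weights
-- 2(1 − γ) and 1 + γ sum to 3 − γ, and by ℓ(C) ≤ (1 + γ)|C| the corresponding weighted sum of
-- the first two tour lengths is at most 4n, so the shorter of them is short enough.

open import Data.Bool using (Bool)
open import Data.Fin using (Fin)
open import Data.Nat using (ℕ)
open import Defs using (Graph; Subgraph; Acyclic)

module Counting where
  open import Data.Bool using (Bool; true; false; if_then_else_; not; _xor_)
  open import Data.Bool.Properties using (not-distribˡ-xor; xor-same)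
  open import Data.Empty using (⊥-elim)
  open import Data.Fin using (Fin; zero; suc; _≟_)
  open import Data.List using (List; []; _∷_; length; map; allFin; tabulate; deduplicate)
  open import Data.List.Membership.Propositional using (_∈_; _∉_)
  open import Data.List.Membership.Propositional.Properties using (∈-deduplicate⁻; ∈-deduplicate⁺)
  open import Data.List.Relation.Unary.All using ([]; _∷_)
  open import Data.List.Relation.Unary.All.Properties using (All¬⇒¬Any)
  open import Data.List.Relation.Unary.AllPairs using ([]; _∷_)
  open import Data.List.Relation.Unary.Any using (here; there)
  open import Data.List.Relation.Unary.Unique.DecPropositional.Properties using (deduplicate-!)
  open import Data.List.Relation.Unary.Unique.Propositional using (Unique)
  open import Data.Nat using (ℕ; zero; suc; _+_; _%_)
  open import Data.Nat.DivMod using ([m+n]%n≡m%n)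
  open import Data.Nat.ListAction using () renaming (sum to listSum)
  open import Data.Nat.Properties using (+-0-commutativeMonoid; +-comm; +-assoc; +-identityʳ)
  open import Algebra.Properties.CommutativeMonoid.Sum +-0-commutativeMonoid
    using (sum-syntax; sum-cong-≗; ∑-distrib-+) renaming (sum to ∑)
  open import Data.Fin.Properties using (suc-injective)
  open import Function using (_∘_; _⇔_; mk⇔; Equivalence)
  open import Relation.Binary.PropositionalEquality
  open import Relation.Nullary using (Dec; yes; no; does; ¬_)

  𝟙ᵇ : Bool → ℕ
  𝟙ᵇ b = if b then 1 else 0

  𝟙 : ∀ {P : Set} → Dec P → ℕ
  𝟙 d = 𝟙ᵇ (does d)

  𝟙-yes : ∀ {P : Set} (d : Dec P) → P → 𝟙 d ≡ 1
  𝟙-yes (yes _) _ = refl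
  𝟙-yes (no ¬p) p = ⊥-elim (¬p p)

  𝟙-no : ∀ {P : Set} (d : Dec P) → ¬ P → 𝟙 d ≡ 0
  𝟙-no (yes p) ¬p = ⊥-elim (¬p p)
  𝟙-no (no _) _ = refl

  𝟙-cong : ∀ {P Q : Set} (p : Dec P) (q : Dec Q) → P ⇔ Q → 𝟙 p ≡ 𝟙 q
  𝟙-cong p (yes q) P⇔Q = 𝟙-yes p (Equivalence.from P⇔Q q)
  𝟙-cong p (no ¬q) P⇔Q = 𝟙-no p (¬q ∘ Equivalence.to P⇔Q)

  δ : ∀ {n} → Fin n → Fin n → ℕ
  δ x y = 𝟙 (x ≟ y)

  δ-refl : ∀ {n} (x : Fin n) → δ x x ≡ 1
  δ-refl x = 𝟙-yes (x ≟ x) refl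

  δ-≢ : ∀ {n} {x y : Fin n} → x ≢ y → δ x y ≡ 0
  δ-≢ {x = x} {y} = 𝟙-no (x ≟ y)

  δ-drop : ∀ {n} {x y : Fin n} → x ≢ y → ∀ a b → a + δ x y + b ≡ a + b
  δ-drop x≢y a b = cong (_+ b) (trans (cong (a +_) (δ-≢ x≢y)) (+-identityʳ a))

  ∑-const-0 : ∀ n → ∑[ i < n ] 0 ≡ 0
  ∑-const-0 zero = refl
  ∑-const-0 (suc n) = ∑-const-0 n

  ∑-const-1 : ∀ n → ∑[ i < n ] 1 ≡ n
  ∑-const-1 zero = refl
  ∑-const-1 (suc n) = cong suc (∑-const-1 n)

  ∑-δ : ∀ {n} (y : Fin n) → ∑[ x < n ] δ x y ≡ 1
  ∑-δ {suc n} zero = cong suc (∑-const-0 n)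
  ∑-δ {suc n} (suc y) = trans (sum-cong-≗ (λ x → 𝟙-cong (suc x ≟ suc y) (x ≟ y) (mk⇔ suc-injective (cong suc)))) (∑-δ y)

  ∑-tabulate : ∀ {n} {A : Set} (f : A → ℕ) (g : Fin n → A) → listSum (map f (tabulate g)) ≡ ∑[ i < n ] f (g i)
  ∑-tabulate {zero} f g = refl
  ∑-tabulate {suc n} f g = cong (f (g zero) +_) (∑-tabulate f (g ∘ suc))

  ∑-allFin : ∀ {n} (f : Fin n → ℕ) → listSum (map f (allFin n)) ≡ ∑[ i < n ] f i
  ∑-allFin f = ∑-tabulate f (λ i → i)

  isOdd : ℕ → Bool
  isOdd zero = false
  isOdd (suc n) = not (isOdd n)

  isOdd-+ : ∀ a b → isOdd (a + b) ≡ isOdd a xor isOdd b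
  isOdd-+ zero b = refl
  isOdd-+ (suc a) b = trans (cong not (isOdd-+ a b)) (not-distribˡ-xor (isOdd a) (isOdd b))

  isOdd-double : ∀ a → isOdd (a + a) ≡ false
  isOdd-double a = trans (isOdd-+ a a) (xor-same (isOdd a))

  isOdd-𝟙ᵇ : ∀ b → isOdd (𝟙ᵇ b) ≡ b
  isOdd-𝟙ᵇ true = refl
  isOdd-𝟙ᵇ false = refl

  isOdd⇒%2≡1 : ∀ m → isOdd m ≡ true → m % 2 ≡ 1
  isOdd⇒%2≡1 (suc zero) _ = refl
  isOdd⇒%2≡1 (suc (suc m)) odd =
    trans (cong (_% 2) (+-comm 2 m)) (trans ([m+n]%n≡m%n m 2) (isOdd⇒%2≡1 m (not-not odd)))
    where
    not-not : ∀ {b} → not (not b) ≡ true → b ≡ true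
    not-not {true} _ = refl

  isOdd-∑ : ∀ {n} (f : Fin n → ℕ) → isOdd (∑[ i < n ] f i) ≡ isOdd (∑[ i < n ] 𝟙ᵇ (isOdd (f i)))
  isOdd-∑ {zero} f = refl
  isOdd-∑ {suc n} f = begin
    isOdd (f zero + ∑[ i < n ] f (suc i))
      ≡⟨ isOdd-+ (f zero) _ ⟩
    isOdd (f zero) xor isOdd (∑[ i < n ] f (suc i))
      ≡⟨ cong₂ _xor_ (sym (isOdd-𝟙ᵇ (isOdd (f zero)))) (isOdd-∑ (f ∘ suc)) ⟩
    isOdd (𝟙ᵇ (isOdd (f zero))) xor isOdd (∑[ i < n ] 𝟙ᵇ (isOdd (f (suc i))))
      ≡⟨ isOdd-+ (𝟙ᵇ (isOdd (f zero))) _ ⟨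
    isOdd (∑[ i < suc n ] 𝟙ᵇ (isOdd (f i))) ∎
    where open ≡-Reasoning

  handshake : ∀ {n} (a : Fin n → Fin n → ℕ) → (∀ x y → a x y ≡ a y x) → (∀ x → a x x ≡ 0) →
              isOdd (∑[ x < n ] ∑[ y < n ] a x y) ≡ false
  handshake {zero} a a-sym a-irr = refl
  handshake {suc n} a a-sym a-irr = begin
    isOdd (∑[ x < suc n ] ∑[ y < suc n ] a x y)
      ≡⟨ cong isOdd split ⟩
    isOdd ((S + S) + R)
      ≡⟨ isOdd-+ (S + S) R ⟩
    isOdd (S + S) xor isOdd R
      ≡⟨ cong₂ _xor_ (isOdd-double S) (handshake a′ (λ x y → a-sym (suc x) (suc y)) (a-irr ∘ suc)) ⟩
    false ∎
    where
    open ≡-Reasoning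
    a′ : Fin n → Fin n → ℕ
    a′ x y = a (suc x) (suc y)
    S R : ℕ
    S = ∑[ y < n ] a zero (suc y)
    R = ∑[ x < n ] ∑[ y < n ] a′ x y
    split : ∑[ x < suc n ] ∑[ y < suc n ] a x y ≡ (S + S) + R
    split = begin
      (a zero zero + S) + ∑[ x < n ] (a (suc x) zero + ∑[ y < n ] a′ x y)
        ≡⟨ cong₂ _+_ (cong (_+ S) (a-irr zero)) (∑-distrib-+ (λ x → a (suc x) zero) (λ x → ∑[ y < n ] a′ x y)) ⟩
      S + (∑[ x < n ] a (suc x) zero + R)
        ≡⟨ cong (λ s → S + (s + R)) (sum-cong-≗ (λ x → a-sym (suc x) zero)) ⟩
      S + (S + R)
        ≡⟨ +-assoc S S R ⟨
      (S + S) + R ∎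

  module _ {n : ℕ} where
    open import Data.List.Membership.DecPropositional (_≟_ {n}) using (_∈?_)

    count : List (Fin n) → ℕ
    count xs = ∑[ y < n ] 𝟙 (y ∈? xs)

    count-cong : ∀ {xs ys} → (∀ y → y ∈ xs ⇔ y ∈ ys) → count xs ≡ count ys
    count-cong {xs} {ys} same = sum-cong-≗ (λ y → 𝟙-cong (y ∈? xs) (y ∈? ys) (same y))

    𝟙-∈-∷ : ∀ {x xs} → x ∉ xs → ∀ y → 𝟙 (y ∈? x ∷ xs) ≡ δ y x + 𝟙 (y ∈? xs)
    𝟙-∈-∷ {x} {xs} x∉ y = by-cases (y ≟ x)
      where
      by-cases : Dec (y ≡ x) → 𝟙 (y ∈? x ∷ xs) ≡ δ y x + 𝟙 (y ∈? xs)
      by-cases (yes y≡x) = trans (𝟙-yes (y ∈? x ∷ xs) (here y≡x))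
        (sym (cong₂ _+_ (𝟙-yes (y ≟ x) y≡x) (𝟙-no (y ∈? xs) (x∉ ∘ subst (_∈ xs) y≡x))))
      by-cases (no y≢x) = trans (𝟙-cong (y ∈? x ∷ xs) (y ∈? xs) (mk⇔ drop-x there)) (cong (_+ 𝟙 (y ∈? xs)) (sym (δ-≢ y≢x)))
        where
        drop-x : y ∈ x ∷ xs → y ∈ xs
        drop-x (here y≡x) = ⊥-elim (y≢x y≡x)
        drop-x (there y∈) = y∈

    multiplicity : List (Fin n) → Fin n → ℕ
    multiplicity [] x = 0
    multiplicity (j ∷ js) x = δ x j + multiplicity js x

    multiplicity-unique : ∀ {js} → Unique js → ∀ x → multiplicity js x ≡ 𝟙 (x ∈? js)
    multiplicity-unique [] x = refl
    multiplicity-unique (j∉ ∷ unique) x =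
      trans (cong (δ x _ +_) (multiplicity-unique unique x)) (sym (𝟙-∈-∷ (All¬⇒¬Any j∉) x))

    count-∷ : ∀ {x xs} → x ∉ xs → count (x ∷ xs) ≡ suc (count xs)
    count-∷ {x} {xs} x∉ = begin
      count (x ∷ xs)                           ≡⟨ sum-cong-≗ (𝟙-∈-∷ x∉) ⟩
      ∑[ y < n ] (δ y x + 𝟙 (y ∈? xs))         ≡⟨ ∑-distrib-+ (λ y → δ y x) _ ⟩
      ∑[ y < n ] δ y x + count xs              ≡⟨ cong (_+ count xs) (∑-δ x) ⟩
      suc (count xs)                           ∎
      where open ≡-Reasoning

    count-unique : ∀ {xs} → Unique xs → count xs ≡ length xs
    count-unique {[]} [] = ∑-const-0 n
    count-unique {x ∷ xs} (x∉ ∷ unique) = trans (count-∷ (All¬⇒¬Any x∉)) (cong suc (count-unique unique))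

    count-deduplicate : ∀ xs → count xs ≡ length (deduplicate _≟_ xs)
    count-deduplicate xs = trans
      (count-cong (λ y → mk⇔ (∈-deduplicate⁺ _≟_) (∈-deduplicate⁻ _≟_ xs)))
      (count-unique (deduplicate-! _≟_ xs))

    count-complete : ∀ {xs} → (∀ y → y ∈ xs) → count xs ≡ n
    count-complete {xs} complete = trans (sum-cong-≗ (λ y → 𝟙-yes (y ∈? xs) (complete y))) (∑-const-1 n)

module Walks {n : ℕ} (G : Graph n) where
  open import Defs hiding (sym)
  open Counting
  open import Data.Fin using (Fin)
  open import Data.List using (List; []; _∷_; length; last)
  open import Data.List.Membership.Propositional using (_∈_)
  open import Data.List.Relation.Binary.Subset.Propositional using (_⊆_)
  open import Data.List.Relation.Unary.Any using (here; there)
  open import Data.List.Relation.Unary.Linked using (Linked; [-]; _∷_)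
  open import Data.Maybe using (just)
  open import Data.Maybe.Properties using (just-injective)
  open import Data.Nat using (ℕ; suc; _+_)
  open import Data.Nat.Properties using (+-comm)
  open import Data.Product using (Σ; _×_; _,_; proj₁)
  open import Data.Sum using (_⊎_; inj₁; inj₂)
  open import Relation.Binary.PropositionalEquality

  Adj-sym : ∀ {u v} → Adj G u v → Adj G v u
  Adj-sym {u} {v} uv = trans (Graph.sym G v u) uv

  infix  4 _⇝_
  infixr 5 _∷ʷ_ _++ʷ_

  data _⇝_ : Fin n → Fin n → Set where
    [_]  : ∀ u → u ⇝ u
    _∷ʷ_ : ∀ {u v w} → Adj G u v → v ⇝ w → u ⇝ w

  tailVertices : ∀ {a b} → a ⇝ b → List (Fin n)
  tailVertices [ _ ] = []
  tailVertices (_∷ʷ_ {v = v} _ w) = v ∷ tailVertices w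

  vertices : ∀ {a b} → a ⇝ b → List (Fin n)
  vertices {a} w = a ∷ tailVertices w

  Spans : ∀ {a b} → a ⇝ b → Set
  Spans w = ∀ y → y ∈ vertices w

  ℓ : ∀ {a b} → a ⇝ b → ℕ
  ℓ [ _ ] = 0
  ℓ (_ ∷ʷ w) = suc (ℓ w)

  edge : ∀ {u v} → Adj G u v → u ⇝ v
  edge {v = v} uv = uv ∷ʷ [ v ]

  _++ʷ_ : ∀ {a b c} → a ⇝ b → b ⇝ c → a ⇝ c
  [ _ ] ++ʷ q = q
  (e ∷ʷ p) ++ʷ q = e ∷ʷ (p ++ʷ q)

  ℓ-++ : ∀ {a b c} (p : a ⇝ b) (q : b ⇝ c) → ℓ (p ++ʷ q) ≡ ℓ p + ℓ q
  ℓ-++ [ _ ] q = refl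
  ℓ-++ (e ∷ʷ p) q = cong suc (ℓ-++ p q)

  ∈-++⁻ : ∀ {a b c} (p : a ⇝ b) (q : b ⇝ c) {y} → y ∈ vertices (p ++ʷ q) → y ∈ vertices p ⊎ y ∈ vertices q
  ∈-++⁻ [ _ ] q y∈ = inj₂ y∈
  ∈-++⁻ (e ∷ʷ p) q (here y≡a) = inj₁ (here y≡a)
  ∈-++⁻ (e ∷ʷ p) q (there y∈) with ∈-++⁻ p q y∈
  ... | inj₁ y∈p = inj₁ (there y∈p)
  ... | inj₂ y∈q = inj₂ y∈q

  ∈-++⁺ˡ : ∀ {a b c} (p : a ⇝ b) (q : b ⇝ c) → vertices p ⊆ vertices (p ++ʷ q)
  ∈-++⁺ˡ [ _ ] [ _ ] y∈ = y∈
  ∈-++⁺ˡ [ _ ] (e ∷ʷ q) (here y≡a) = here y≡a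
  ∈-++⁺ˡ (e ∷ʷ p) q (here y≡a) = here y≡a
  ∈-++⁺ˡ (e ∷ʷ p) q (there y∈) = there (∈-++⁺ˡ p q y∈)

  ∈-++⁺ʳ : ∀ {a b c} (p : a ⇝ b) (q : b ⇝ c) → vertices q ⊆ vertices (p ++ʷ q)
  ∈-++⁺ʳ [ _ ] q y∈ = y∈
  ∈-++⁺ʳ (e ∷ʷ p) q y∈ = there (∈-++⁺ʳ p q y∈)

  reverse : ∀ {a b} → a ⇝ b → b ⇝ a
  reverse [ u ] = [ u ]
  reverse (e ∷ʷ w) = reverse w ++ʷ edge (Adj-sym e)

  ℓ-reverse : ∀ {a b} (w : a ⇝ b) → ℓ (reverse w) ≡ ℓ w
  ℓ-reverse [ _ ] = refl
  ℓ-reverse (e ∷ʷ w) = trans (ℓ-++ (reverse w) _) (trans (+-comm (ℓ (reverse w)) 1) (cong suc (ℓ-reverse w)))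

  ∈-reverse⁺ : ∀ {a b} (w : a ⇝ b) → vertices w ⊆ vertices (reverse w)
  ∈-reverse⁺ [ _ ] y∈ = y∈
  ∈-reverse⁺ (e ∷ʷ w) (here y≡a) = ∈-++⁺ʳ (reverse w) (edge (Adj-sym e)) (there (here y≡a))
  ∈-reverse⁺ (e ∷ʷ w) (there y∈) = ∈-++⁺ˡ (reverse w) _ (∈-reverse⁺ w y∈)

  ∈-reverse⁻ : ∀ {a b} (w : a ⇝ b) → vertices (reverse w) ⊆ vertices w
  ∈-reverse⁻ [ _ ] y∈ = y∈
  ∈-reverse⁻ (e ∷ʷ w) y∈ with ∈-++⁻ (reverse w) (edge (Adj-sym e)) y∈
  ... | inj₁ y∈rw = there (∈-reverse⁻ w y∈rw)
  ... | inj₂ (here y≡v) = there (here y≡v)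
  ... | inj₂ (there (here y≡a)) = here y≡a

  target∈ : ∀ {a b} (w : a ⇝ b) → b ∈ vertices w
  target∈ [ _ ] = here refl
  target∈ (e ∷ʷ w) = there (target∈ w)

  splitAt : ∀ {a b y} (w : a ⇝ b) → y ∈ vertices w → Σ (a ⇝ y) λ p → Σ (y ⇝ b) λ q → p ++ʷ q ≡ w
  splitAt [ u ] (here refl) = [ u ] , [ u ] , refl
  splitAt (e ∷ʷ w) (here refl) = [ _ ] , e ∷ʷ w , refl
  splitAt (e ∷ʷ w) (there y∈) with splitAt w y∈
  ... | p , q , p++q≡w = e ∷ʷ p , q , cong (e ∷ʷ_) p++q≡w

  rotate : ∀ {u y} (w : u ⇝ u) → y ∈ vertices w → Σ (y ⇝ y) λ w′ → ℓ w′ ≡ ℓ w × vertices w ⊆ vertices w′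
  rotate w y∈ with splitAt w y∈
  ... | p , q , refl = q ++ʷ p , trans (ℓ-++ q p) (trans (+-comm (ℓ q) (ℓ p)) (sym (ℓ-++ p q))) , moved
    where
    moved : vertices (p ++ʷ q) ⊆ vertices (q ++ʷ p)
    moved y∈pq with ∈-++⁻ p q y∈pq
    ... | inj₁ y∈p = ∈-++⁺ʳ q p y∈p
    ... | inj₂ y∈q = ∈-++⁺ˡ q p y∈q

  linked-vertices : ∀ {a b} (w : a ⇝ b) → Linked (Adj G) (vertices w)
  linked-vertices [ _ ] = [-]
  linked-vertices (e ∷ʷ w) = e ∷ linked-vertices w

  last≡target : ∀ {a b} (w : a ⇝ b) → last (vertices w) ≡ just b
  last≡target [ _ ] = refl
  last≡target (e ∷ʷ w) = last≡target w

  length-tailVertices : ∀ {a b} (w : a ⇝ b) → length (tailVertices w) ≡ ℓ w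
  length-tailVertices [ _ ] = refl
  length-tailVertices (e ∷ʷ w) = cong suc (length-tailVertices w)

  toWalk : ∀ {a b} → a ⇝ b → Walk G a b
  toWalk w = record { rest = tailVertices w ; linked = linked-vertices w ; ends = last≡target w }

  fromWalk : ∀ {a b} (w : Walk G a b) → Σ (a ⇝ b) λ w′ → tailVertices w′ ≡ Walk.rest w
  fromWalk {a} w = go a (Walk.rest w) (Walk.linked w) (Walk.ends w)
    where
    go : ∀ {b} a rest → Linked (Adj G) (a ∷ rest) → last (a ∷ rest) ≡ just b →
         Σ (a ⇝ b) λ w′ → tailVertices w′ ≡ rest
    go a [] [-] ends with just-injective ends
    ... | refl = [ a ] , refl
    go a (x ∷ rest) (e ∷ lnk) ends with go x rest lnk ends
    ... | w′ , tail≡ = e ∷ʷ w′ , cong (x ∷_) tail≡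

  toClosedWalk : ∀ {a} → a ⇝ a → ClosedWalk G
  toClosedWalk {a} w = a , toWalk w

  len-toClosedWalk : ∀ {a} (w : a ⇝ a) → len (toClosedWalk w) ≡ ℓ w
  len-toClosedWalk = length-tailVertices

  record Underlying (C : ClosedWalk G) : Set where
    field
      walk              : proj₁ C ⇝ proj₁ C
      len≡ℓ             : len C ≡ ℓ walk
      numDistinct≡count : numDistinct C ≡ count (vertices walk)
      visits⇒∈          : ∀ v → Visits C v → v ∈ vertices walk

  underlying : (C : ClosedWalk G) → Underlying C
  underlying (u , cw) with fromWalk cw
  ... | w , refl = record
    { walk              = w
    ; len≡ℓ             = length-tailVertices w
    ; numDistinct≡count = sym (count-deduplicate (vertices w))
    ; visits⇒∈          = λ v v∈ → v∈
    }

module Detours {n : ℕ} (G : Graph n) where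
  open import Defs hiding (sym)
  open Counting
  open import Data.Fin using (Fin; _≟_)
  open import Data.List using (List; []; _∷_; allFin)
  open import Data.List.Membership.Propositional using (_∈_; _∉_)
  open import Data.List.Membership.Propositional.Properties using (∈-allFin)
  open import Data.List.Relation.Binary.Subset.Propositional using (_⊆_)
  open import Data.List.Relation.Unary.Any using (here; there)
  open import Data.Nat using (ℕ; _+_; _*_)
  open import Data.Nat.Properties using (+-assoc; +-comm; +-identityʳ; *-distribˡ-+)
  open import Data.Nat.Tactic.RingSolver using (solve-∀)
  open import Data.Product using (Σ; _×_; _,_; proj₁)
  open import Data.Sum using (inj₁; inj₂)
  open import Function using (_∘_; mk⇔)
  open import Relation.Binary.PropositionalEquality
  open import Relation.Nullary using (yes; no)
  open Walks G
  open import Data.List.Membership.DecPropositional (_≟_ {n}) using (_∈?_)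

  infix 4 _≼_

  record _≼_ {r} (w w′ : r ⇝ r) : Set where
    field
      added      : ℕ
      ℓ-≡        : ℓ w′ ≡ ℓ w + 2 * added
      count-≡    : count (vertices w′) ≡ count (vertices w) + added
      ⊆-vertices : vertices w ⊆ vertices w′

  open _≼_

  ≼-refl : ∀ {r} (w : r ⇝ r) → w ≼ w
  ≼-refl w = record { added = 0 ; ℓ-≡ = sym (+-identityʳ _) ; count-≡ = sym (+-identityʳ _) ; ⊆-vertices = λ y∈ → y∈ }

  ≼-trans : ∀ {r} {w₁ w₂ w₃ : r ⇝ r} → w₁ ≼ w₂ → w₂ ≼ w₃ → w₁ ≼ w₃
  ≼-trans {w₁ = w₁} {w₂} {w₃} e₁ e₂ = record
    { added      = added e₁ + added e₂
    ; ℓ-≡        = begin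
        ℓ w₃                                     ≡⟨ ℓ-≡ e₂ ⟩
        ℓ w₂ + 2 * added e₂                      ≡⟨ cong (_+ 2 * added e₂) (ℓ-≡ e₁) ⟩
        ℓ w₁ + 2 * added e₁ + 2 * added e₂       ≡⟨ +-assoc (ℓ w₁) _ _ ⟩
        ℓ w₁ + (2 * added e₁ + 2 * added e₂)     ≡⟨ cong (ℓ w₁ +_) (*-distribˡ-+ 2 (added e₁) (added e₂)) ⟨
        ℓ w₁ + 2 * (added e₁ + added e₂)         ∎
    ; count-≡    = trans (count-≡ e₂) (trans (cong (_+ added e₂) (count-≡ e₁)) (+-assoc _ (added e₁) (added e₂)))
    ; ⊆-vertices = ⊆-vertices e₂ ∘ ⊆-vertices e₁
    }
    where open ≡-Reasoning

  detour : ∀ {r u v} (w : r ⇝ r) → u ∈ vertices w → Adj G u v → v ∉ vertices w →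
           Σ (r ⇝ r) λ w′ → w ≼ w′ × v ∈ vertices w′
  detour {r} {u} {v} w u∈ uv v∉ with splitAt w u∈
  ... | p , q , refl = w′ , extends , v∈w′
    where
    there-and-back : u ⇝ u
    there-and-back = uv ∷ʷ Adj-sym uv ∷ʷ [ u ]
    w′ : r ⇝ r
    w′ = p ++ʷ (there-and-back ++ʷ q)
    v∈w′ : v ∈ vertices w′
    v∈w′ = ∈-++⁺ʳ p _ (∈-++⁺ˡ there-and-back q (there (here refl)))
    new : ∀ {y} → y ∈ vertices w′ → y ∈ v ∷ vertices (p ++ʷ q)
    new y∈ with ∈-++⁻ p _ y∈
    ... | inj₁ y∈p = there (∈-++⁺ˡ p q y∈p)
    ... | inj₂ y∈r with ∈-++⁻ there-and-back q y∈r
    ...   | inj₂ y∈q = there (∈-++⁺ʳ p q y∈q)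
    ...   | inj₁ (here refl) = there u∈
    ...   | inj₁ (there (here refl)) = here refl
    ...   | inj₁ (there (there (here refl))) = there u∈
    old : vertices (p ++ʷ q) ⊆ vertices w′
    old y∈ with ∈-++⁻ p q y∈
    ... | inj₁ y∈p = ∈-++⁺ˡ p _ y∈p
    ... | inj₂ y∈q = ∈-++⁺ʳ p _ (∈-++⁺ʳ there-and-back q y∈q)
    extends : p ++ʷ q ≼ w′
    extends = record
      { added      = 1
      ; ℓ-≡        = begin
          ℓ w′                  ≡⟨ ℓ-++ p _ ⟩
          ℓ p + (2 + ℓ q)       ≡⟨ cong (ℓ p +_) (+-comm 2 (ℓ q)) ⟩
          ℓ p + (ℓ q + 2)       ≡⟨ +-assoc (ℓ p) (ℓ q) 2 ⟨
          ℓ p + ℓ q + 2         ≡⟨ cong (_+ 2) (ℓ-++ p q) ⟨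
          ℓ (p ++ʷ q) + 2 * 1   ∎
      ; count-≡    = trans (count-cong (λ y → mk⇔ new λ { (here refl) → v∈w′ ; (there y∈) → old y∈ }))
                           (trans (count-∷ v∉) (+-comm 1 _))
      ; ⊆-vertices = old
      }
      where open ≡-Reasoning

  cover : ∀ {r a b} (w : r ⇝ r) → a ⇝ b → a ∈ vertices w → Σ (r ⇝ r) λ w′ → w ≼ w′ × b ∈ vertices w′
  cover w [ _ ] a∈ = w , ≼-refl w , a∈
  cover w (_∷ʷ_ {v = x} e P) a∈ with x ∈? vertices w
  ... | yes x∈ = cover w P x∈
  ... | no x∉ with detour w a∈ e x∉
  ...   | w₁ , w≼w₁ , x∈ with cover w₁ P x∈
  ...     | w₂ , w₁≼w₂ , b∈ = w₂ , ≼-trans w≼w₁ w₁≼w₂ , b∈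

  coverAll : ∀ {r} → Connected G → (ys : List (Fin n)) (w : r ⇝ r) → Σ (r ⇝ r) λ w′ → w ≼ w′ × ys ⊆ vertices w′
  coverAll con [] w = w , ≼-refl w , λ ()
  coverAll {r} con (y ∷ ys) w with cover w (proj₁ (fromWalk (con r y))) (here refl)
  ... | w₁ , w≼w₁ , y∈ with coverAll con ys w₁
  ...   | w₂ , w₁≼w₂ , ys⊆ = w₂ , ≼-trans w≼w₁ w₁≼w₂ ,
          λ { (here refl) → ⊆-vertices w₁≼w₂ y∈ ; (there z∈) → ys⊆ z∈ }

  spanningExtension : ∀ {r} → Connected G → (w : r ⇝ r) →
    Σ (r ⇝ r) λ w′ → Spans w′ × ℓ w′ + 2 * count (vertices w) ≡ ℓ w + 2 * n
  spanningExtension con w with coverAll con (allFin n) w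
  ... | w′ , w≼w′ , all⊆ = w′ , spans , length-bound
    where
    open ≡-Reasoning
    k a : ℕ
    k = count (vertices w)
    a = added w≼w′
    spans : Spans w′
    spans y = all⊆ (∈-allFin y)
    rearrange : ∀ l a k → l + 2 * a + 2 * k ≡ l + 2 * (k + a)
    rearrange = solve-∀
    length-bound : ℓ w′ + 2 * k ≡ ℓ w + 2 * n
    length-bound = begin
      ℓ w′ + 2 * k                ≡⟨ cong (_+ 2 * k) (ℓ-≡ w≼w′) ⟩
      ℓ w + 2 * a + 2 * k         ≡⟨ rearrange (ℓ w) a k ⟩
      ℓ w + 2 * (k + a)           ≡⟨ cong (λ m → ℓ w + 2 * m) (trans (sym (count-≡ w≼w′)) (count-complete spans)) ⟩
      ℓ w + 2 * n                 ∎

module Tree {n : ℕ} (T : Graph n) where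
  open import Defs hiding (sym)
  open Counting
  open import Data.Empty using (⊥-elim)
  open import Data.Fin using (Fin; _≟_)
  open import Data.List using (List; []; _∷_; length; allFin)
  open import Data.List.Membership.Propositional using (_∈_; _∉_)
  open import Data.List.Membership.Propositional.Properties using (∈-allFin)
  open import Data.List.Relation.Binary.Subset.Propositional using (_⊆_)
  open import Data.List.Relation.Unary.All.Properties using (¬Any⇒All¬)
  open import Data.List.Relation.Unary.All using ([])
  open import Data.List.Relation.Unary.AllPairs using ([]; _∷_)
  open import Data.List.Relation.Unary.Any using (here; there)
  open import Data.List.Relation.Unary.Linked using (_∷_)
  open import Data.List.Relation.Unary.Unique.Propositional using (Unique)
  open import Data.Maybe.Properties using (just-injective)
  open import Data.Nat using (ℕ; suc; _≤_; _<_; z≤n; s≤s)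
  open import Data.Nat.Properties using (≤-reflexive)
  open import Data.Product using (Σ; _×_; _,_; proj₁)
  open import Data.Sum using (inj₁; inj₂)
  open import Function using (_∘_)
  open import Relation.Binary.PropositionalEquality
  open import Relation.Nullary using (yes; no)
  open Walks T
  open import Data.List.Membership.DecPropositional (_≟_ {n}) using (_∈?_)

  UniquePath : ∀ {a b} → a ⇝ b → Set
  UniquePath w = Unique (vertices w)

  dropUntil : ∀ {a x b} (w : x ⇝ b) → a ∈ vertices w → UniquePath w →
              Σ (a ⇝ b) λ q → UniquePath q × vertices q ⊆ vertices w
  dropUntil w (here refl) uniq = w , uniq , λ y∈ → y∈
  dropUntil (e ∷ʷ w) (there a∈) (_ ∷ uniq) with dropUntil w a∈ uniq
  ... | q , uniq-q , q⊆w = q , uniq-q , there ∘ q⊆w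

  loopErase : ∀ {a b} (w : a ⇝ b) → Σ (a ⇝ b) λ q → UniquePath q × vertices q ⊆ vertices w
  loopErase [ a ] = [ a ] , [] ∷ [] , λ y∈ → y∈
  loopErase {a} (e ∷ʷ w) with loopErase w
  ... | w′ , uniq , w′⊆w with a ∈? vertices w′
  ...   | yes a∈ with dropUntil w′ a∈ uniq
  ...     | q , uniq-q , q⊆w′ = q , uniq-q , there ∘ w′⊆w ∘ q⊆w′
  loopErase {a} (e ∷ʷ w) | w′ , uniq , w′⊆w | no a∉ =
    e ∷ʷ w′ , ¬Any⇒All¬ _ a∉ ∷ uniq , λ { (here y≡a) → here y≡a ; (there y∈) → there (w′⊆w y∈) }

  module _ (r : Fin n) where

    data Growth : List (Fin n) → Set where
      root   : Growth (r ∷ [])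
      attach : ∀ {S} v p → Growth S → v ∉ S → p ∈ S → Adj T v p → Growth (v ∷ S)

    attachments : ∀ {S} → Growth S → ℕ
    attachments root = 0
    attachments (attach _ _ g _ _ _) = suc (attachments g)

    root∈ : ∀ {S} → Growth S → r ∈ S
    root∈ root = here refl
    root∈ (attach _ _ g _ _ _) = there (root∈ g)

    growth-unique : ∀ {S} → Growth S → Unique S
    growth-unique root = [] ∷ []
    growth-unique (attach v p g v∉ p∈ e) = ¬Any⇒All¬ _ v∉ ∷ growth-unique g

    length-growth : ∀ {S} (g : Growth S) → suc (attachments g) ≡ length S
    length-growth root = refl
    length-growth (attach _ _ g _ _ _) = cong suc (length-growth g)

    attachments<n : ∀ {S} (g : Growth S) → (∀ y → y ∈ S) → attachments g < n
    attachments<n {S} g spanning = ≤-reflexive (begin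
      suc (attachments g)    ≡⟨ length-growth g ⟩
      length S               ≡⟨ count-unique (growth-unique g) ⟨
      count S                ≡⟨ count-complete spanning ⟩
      n                      ∎)
      where open ≡-Reasoning

    walkToRoot : ∀ {S x} → Growth S → x ∈ S → Σ (x ⇝ r) λ w → vertices w ⊆ S
    walkToRoot root (here refl) = [ r ] , λ y∈ → y∈
    walkToRoot (attach v p g v∉ p∈ e) (here refl) with walkToRoot g p∈
    ... | w , w⊆S = e ∷ʷ w , λ { (here y≡v) → here y≡v ; (there y∈) → there (w⊆S y∈) }
    walkToRoot (attach v p g v∉ p∈ e) (there x∈) with walkToRoot g x∈
    ... | w , w⊆S = w , there ∘ w⊆S

    attached-is-leaf : Acyclic T → ∀ {S v p} → Growth S → v ∉ S → p ∈ S → Adj T v p →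
                       ∀ {x} → x ∈ S → Adj T v x → x ≡ p
    attached-is-leaf acyclic {S} {v} {p} g v∉ p∈ vp {x} x∈ vx with x ≟ p
    ... | yes x≡p = x≡p
    ... | no x≢p with walkToRoot g x∈ | walkToRoot g p∈
    ...   | wx , wx⊆S | wp , wp⊆S with loopErase (wx ++ʷ reverse wp)
    ...     | [ _ ] , _ , _ = ⊥-elim (x≢p refl)
    ...     | (e ∷ʷ q) , uniq , q⊆ = ⊥-elim (acyclic cycle)
      where
      path⊆S : vertices (e ∷ʷ q) ⊆ S
      path⊆S y∈ with ∈-++⁻ wx (reverse wp) (q⊆ y∈)
      ... | inj₁ y∈wx = wx⊆S y∈wx
      ... | inj₂ y∈wp = wp⊆S (∈-reverse⁻ wp y∈wp)
      cycle : Cycle T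
      cycle = record
        { cverts   = v ∷ vertices (e ∷ʷ q)
        ; long     = s≤s (s≤s (s≤s z≤n))
        ; distinct = ¬Any⇒All¬ _ (v∉ ∘ path⊆S) ∷ uniq
        ; clinked  = vx ∷ linked-vertices (e ∷ʷ q)
        ; closing  = λ { _ _ refl last≡ →
                         subst (λ z → Adj T z v) (just-injective (trans (sym (last≡target q)) last≡)) (Adj-sym vp) }
        }

    extendAlong : ∀ {S a b} → Growth S → a ⇝ b → a ∈ S → Σ (List (Fin n)) λ S′ → Growth S′ × b ∈ S′ × S ⊆ S′
    extendAlong g [ _ ] a∈ = _ , g , a∈ , λ y∈ → y∈
    extendAlong {S} g (_∷ʷ_ {v = x} e w) a∈ with x ∈? S
    ... | yes x∈ = extendAlong g w x∈
    ... | no x∉ with extendAlong (attach x _ g x∉ a∈ (Adj-sym e)) w (here refl)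
    ...   | S′ , g′ , b∈ , S⊆ = S′ , g′ , b∈ , S⊆ ∘ there

    extendToAll : Connected T → ∀ {S} → Growth S → (ys : List (Fin n)) →
                  Σ (List (Fin n)) λ S′ → Growth S′ × ys ⊆ S′ × S ⊆ S′
    extendToAll con g [] = _ , g , (λ ()) , (λ y∈ → y∈)
    extendToAll con g (y ∷ ys) with extendAlong g (proj₁ (fromWalk (con r y))) (root∈ g)
    ... | S₁ , g₁ , y∈ , S⊆S₁ with extendToAll con g₁ ys
    ...   | S₂ , g₂ , ys⊆ , S₁⊆S₂ =
            S₂ , g₂ , (λ { (here refl) → S₁⊆S₂ y∈ ; (there z∈) → ys⊆ z∈ }) , S₁⊆S₂ ∘ S⊆S₁

    spanningGrowth : Connected T → Σ (List (Fin n)) λ S → Growth S × (∀ y → y ∈ S)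
    spanningGrowth con with extendToAll con root (allFin n)
    ... | S , g , all⊆ , _ = S , g , λ y → all⊆ (∈-allFin y)

module OddVertices {n : ℕ} (T : Graph n) where
  open import Defs hiding (sym)
  open Counting
  open import Data.Bool using (true; false; if_then_else_)
  open import Data.Empty using (⊥-elim)
  open import Data.Fin using (Fin; _≟_)
  open import Data.List using (List; []; _∷_)
  open import Data.List.Membership.Propositional using (_∈_; _∉_)
  open import Data.List.Relation.Unary.Any using (here; there)
  open import Data.Nat using (ℕ; _+_)
  open import Data.Nat.Properties using (+-0-commutativeMonoid)
  open import Algebra.Properties.CommutativeMonoid.Sum +-0-commutativeMonoid
    using (sum-syntax; sum-cong-≗; ∑-distrib-+) renaming (sum to ∑)
  open import Function using (_∘_)
  open import Relation.Binary.PropositionalEquality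
  open import Relation.Nullary using (Dec; yes; no)
  open import Data.List.Membership.DecPropositional (_≟_ {n}) using (_∈?_)

  degreeIn : List (Fin n) → Fin n → ℕ
  degreeIn S x = ∑[ w < n ] (if adj T x w then 𝟙 (w ∈? S) else 0)

  oddIn : List (Fin n) → Fin n → ℕ
  oddIn S x = if isOdd (degreeIn S x) then 𝟙 (x ∈? S) else 0

  oddIn-∉ : ∀ {S x} → x ∉ S → oddIn S x ≡ 0
  oddIn-∉ {S} {x} x∉ with isOdd (degreeIn S x)
  ... | true = 𝟙-no (x ∈? S) x∉
  ... | false = refl

  degreeIn-[] : ∀ x → degreeIn [] x ≡ 0
  degreeIn-[] x = trans (sum-cong-≗ none) (∑-const-0 n)
    where
    none : ∀ w → (if adj T x w then 𝟙 (w ∈? []) else 0) ≡ 0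
    none w with adj T x w
    ... | true = refl
    ... | false = refl

  degreeIn-∷ : ∀ {S v} → v ∉ S → ∀ x → degreeIn (v ∷ S) x ≡ 𝟙ᵇ (adj T x v) + degreeIn S x
  degreeIn-∷ {S} {v} v∉ x = begin
    degreeIn (v ∷ S) x                                                  ≡⟨ sum-cong-≗ split ⟩
    ∑[ w < n ] ((if adj T x w then δ w v else 0) + (if adj T x w then 𝟙 (w ∈? S) else 0))
                                                                        ≡⟨ ∑-distrib-+ (λ w → if adj T x w then δ w v else 0) _ ⟩
    ∑[ w < n ] (if adj T x w then δ w v else 0) + degreeIn S x          ≡⟨ cong (_+ degreeIn S x) (sum-cong-≗ only-v) ⟩
    ∑[ w < n ] (if adj T x v then δ w v else 0) + degreeIn S x          ≡⟨ cong (_+ degreeIn S x) (∑-if-δ (adj T x v)) ⟩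
    𝟙ᵇ (adj T x v) + degreeIn S x                                       ∎
      where
      open ≡-Reasoning
      split : ∀ w → (if adj T x w then 𝟙 (w ∈? v ∷ S) else 0)
                  ≡ (if adj T x w then δ w v else 0) + (if adj T x w then 𝟙 (w ∈? S) else 0)
      split w with adj T x w
      ... | true = 𝟙-∈-∷ v∉ w
      ... | false = refl
      only-v : ∀ w → (if adj T x w then δ w v else 0) ≡ (if adj T x v then δ w v else 0)
      only-v w with w ≟ v
      ... | yes refl = refl
      ... | no w≢v = trans (if-0 (adj T x w)) (sym (if-0 (adj T x v)))
        where
        if-0 : ∀ b → (if b then 0 else 0) ≡ 0
        if-0 true = refl
        if-0 false = refl
      ∑-if-δ : ∀ b → ∑[ w < n ] (if b then δ w v else 0) ≡ 𝟙ᵇ b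
      ∑-if-δ true = ∑-δ v
      ∑-if-δ false = ∑-const-0 n

  degreeIn-complete : ∀ {S} → (∀ y → y ∈ S) → ∀ x → degreeIn S x ≡ degree T x
  degreeIn-complete {S} complete x = trans (sum-cong-≗ all-in) (sym (∑-allFin (𝟙ᵇ ∘ adj T x)))
    where
    all-in : ∀ w → (if adj T x w then 𝟙 (w ∈? S) else 0) ≡ 𝟙ᵇ (adj T x w)
    all-in w with adj T x w
    ... | true = 𝟙-yes (w ∈? S) (complete w)
    ... | false = refl

  oddIn-complete : ∀ {S} → (∀ y → y ∈ S) → ∀ x → oddIn S x ≡ 𝟙ᵇ (isOdd (degree T x))
  oddIn-complete {S} complete x rewrite degreeIn-complete complete x with isOdd (degree T x)
  ... | true = 𝟙-yes (x ∈? S) (complete x)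
  ... | false = refl

  oddIn-root : ∀ r x → oddIn (r ∷ []) x ≡ 0
  oddIn-root r x = by-cases x (x ≟ r)
    where
    by-cases : ∀ x → Dec (x ≡ r) → oddIn (r ∷ []) x ≡ 0
    by-cases x (no x≢r) = oddIn-∉ {r ∷ []} λ { (here x≡r) → x≢r x≡r }
    by-cases r (yes refl) rewrite degreeIn-∷ {[]} {r} (λ ()) r | Graph.irrefl T r | degreeIn-[] r = refl

  evenlyManyOddDegrees : isOdd (∑[ v < n ] 𝟙ᵇ (isOdd (degree T v))) ≡ false
  evenlyManyOddDegrees = begin
    isOdd (∑[ v < n ] 𝟙ᵇ (isOdd (degree T v)))   ≡⟨ isOdd-∑ (degree T) ⟨
    isOdd (∑[ v < n ] degree T v)                ≡⟨ cong isOdd (sum-cong-≗ (λ v → ∑-allFin (𝟙ᵇ ∘ adj T v))) ⟩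
    isOdd (∑[ v < n ] ∑[ w < n ] 𝟙ᵇ (adj T v w))  ≡⟨ handshake (λ v w → 𝟙ᵇ (adj T v w))
                                                      (λ v w → cong 𝟙ᵇ (Graph.sym T v w)) (cong 𝟙ᵇ ∘ Graph.irrefl T) ⟩
    false                                        ∎
    where open ≡-Reasoning

  module Leaf {S v p} (v∉ : v ∉ S) (p∈ : p ∈ S) (vp : Adj T v p)
              (leaf : ∀ {x} → x ∈ S → Adj T v x → x ≡ p) where

    degreeIn-leaf : degreeIn S v ≡ 1
    degreeIn-leaf = trans (sum-cong-≗ only-p) (∑-δ p)
      where
      only-p : ∀ w → (if adj T v w then 𝟙 (w ∈? S) else 0) ≡ δ w p
      only-p w with w ≟ p
      ... | yes refl rewrite vp = 𝟙-yes (w ∈? S) p∈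
      ... | no w≢p with adj T v w in vw
      ...   | false = refl
      ...   | true = 𝟙-no (w ∈? S) (λ w∈ → w≢p (leaf w∈ vw))

    oddIn-leaf : oddIn (v ∷ S) v ≡ 1
    oddIn-leaf rewrite degreeIn-∷ v∉ v | Graph.irrefl T v | degreeIn-leaf = 𝟙-yes (v ∈? v ∷ S) (here refl)

    oddIn-parent : oddIn (v ∷ S) p + oddIn S p ≡ 1
    oddIn-parent rewrite degreeIn-∷ v∉ p | trans (Graph.sym T p v) vp
                       | 𝟙-yes (p ∈? v ∷ S) (there p∈) | 𝟙-yes (p ∈? S) p∈ with isOdd (degreeIn S p)
    ... | true = refl
    ... | false = refl

    only-parent-adjacent : ∀ {x} → x ∈ S → x ≢ p → adj T x v ≡ false
    only-parent-adjacent {x} x∈ x≢p with adj T x v in xv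
    ... | true = ⊥-elim (x≢p (leaf x∈ (trans (Graph.sym T v x) xv)))
    ... | false = refl

    oddIn-elsewhere : ∀ {x} → x ≢ v → x ≢ p → oddIn (v ∷ S) x ≡ oddIn S x
    oddIn-elsewhere {x} x≢v x≢p = by-cases (x ∈? S)
      where
      by-cases : Dec (x ∈ S) → oddIn (v ∷ S) x ≡ oddIn S x
      by-cases (no x∉) = trans (oddIn-∉ {v ∷ S} λ { (here x≡v) → x≢v x≡v ; (there x∈) → x∉ x∈ }) (sym (oddIn-∉ {S} x∉))
      by-cases (yes x∈) rewrite degreeIn-∷ v∉ x | only-parent-adjacent x∈ x≢p with isOdd (degreeIn S x)
      ... | true = trans (𝟙-yes (x ∈? v ∷ S) (there x∈)) (sym (𝟙-yes (x ∈? S) x∈))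
      ... | false = refl

module Segments {n : ℕ} (G : Graph n) where
  open import Defs hiding (sym)
  open Counting
  open import Data.Fin using (Fin; _≟_)
  open import Data.List using (List; []; _∷_; length)
  open import Data.List.Membership.Propositional using (_∈_)
  open import Data.List.Relation.Binary.Subset.Propositional using (_⊆_)
  open import Data.List.Relation.Unary.All using (All; []; _∷_)
  open import Data.List.Relation.Unary.Any using (Any; here; there)
  open import Data.Bool using (Bool; true; false; if_then_else_; not)
  open import Data.Nat using (ℕ; _+_; _≤_)
  open import Data.Nat.Properties using (+-comm; +-assoc; +-cancelʳ-≡; +-identityʳ; +-commutativeSemigroup)
  open import Algebra.Properties.CommutativeSemigroup +-commutativeSemigroup using (x∙yz≈y∙xz)
  open import Data.Product using (Σ; _×_; _,_; proj₁; proj₂)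
  open import Data.Sum using (_⊎_; inj₁; inj₂; map₂)
  open import Function using (_∘_)
  open import Relation.Binary.PropositionalEquality
  open import Relation.Nullary using (yes; no)
  open Walks G

  Segment : Set
  Segment = Σ (Fin n) λ a → Σ (Fin n) λ b → a ⇝ b

  Loop : Set
  Loop = Σ (Fin n) λ b → b ⇝ b

  endpoints : List Segment → Fin n → ℕ
  endpoints [] x = 0
  endpoints ((a , b , _) ∷ L) x = δ x a + δ x b + endpoints L x

  ℓˢ : List Segment → ℕ
  ℓˢ [] = 0
  ℓˢ ((_ , _ , w) ∷ L) = ℓ w + ℓˢ L

  ℓˡ : List Loop → ℕ
  ℓˡ [] = 0
  ℓˡ ((_ , w) ∷ Λ) = ℓ w + ℓˡ Λ

  OnSegments : List Segment → Fin n → Set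
  OnSegments L y = Any (λ s → y ∈ vertices (proj₂ (proj₂ s))) L

  OnLoops : List Loop → Fin n → Set
  OnLoops Λ y = Any (λ c → y ∈ vertices (proj₂ c)) Λ

  RootedIn : List (Fin n) → List Loop → Set
  RootedIn S = All (λ c → proj₁ c ∈ S)

  record Extraction (L : List Segment) (v : Fin n) : Set where
    field
      {source}    : Fin n
      path        : source ⇝ v
      others      : List Segment
      endpoints-≡ : ∀ x → endpoints L x ≡ δ x source + δ x v + endpoints others x
      length-≡    : ℓˢ L ≡ ℓ path + ℓˢ others
      onSegments⁻ : ∀ {y} → OnSegments L y → y ∈ vertices path ⊎ OnSegments others y

  extract : ∀ L v → 1 ≤ endpoints L v → Extraction L v
  extract ((a , b , w) ∷ L) v ends≥1 with a ≟ v | b ≟ v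
  ... | yes refl | _ = record
    { path        = reverse w
    ; others      = L
    ; endpoints-≡ = λ x → cong (_+ endpoints L x) (+-comm (δ x a) (δ x b))
    ; length-≡    = cong (_+ ℓˢ L) (sym (ℓ-reverse w))
    ; onSegments⁻ = λ { (here y∈w) → inj₁ (∈-reverse⁺ w y∈w) ; (there y∈L) → inj₂ y∈L }
    }
  ... | no _ | yes refl = record
    { path        = w
    ; others      = L
    ; endpoints-≡ = λ x → refl
    ; length-≡    = refl
    ; onSegments⁻ = λ { (here y∈w) → inj₁ y∈w ; (there y∈L) → inj₂ y∈L }
    }
  ... | no a≢v | no b≢v = record
    { path        = path
    ; others      = (a , b , w) ∷ others
    ; endpoints-≡ = λ x → trans (cong (δ x a + δ x b +_) (endpoints-≡ x)) (x∙yz≈y∙xz (δ x a + δ x b) (δ x source + δ x v) _)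
    ; length-≡    = trans (cong (ℓ w +_) length-≡) (x∙yz≈y∙xz (ℓ w) (ℓ path) (ℓˢ others))
    ; onSegments⁻ = λ { (here y∈w) → inj₂ (here y∈w) ; (there y∈L) → map₂ there (onSegments⁻ y∈L) }
    }
    where
    open Extraction (extract L v (subst (1 ≤_) (cong₂ (λ s t → s + t + endpoints L v) (δ-≢ (a≢v ∘ sym)) (δ-≢ (b≢v ∘ sym))) ends≥1))

  record Absorption {a v} (S : List (Fin n)) (Λ : List Loop) (P : a ⇝ v) : Set where
    field
      path      : a ⇝ v
      remaining : List Loop
      rooted    : RootedIn S remaining
      length-≡  : ℓ path + ℓˡ remaining ≡ ℓ P + ℓˡ Λ
      ⊆-path    : vertices P ⊆ vertices path
      onLoops⁻  : ∀ {y} → OnLoops Λ y → y ∈ vertices path ⊎ OnLoops remaining y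

  absorb : ∀ {S v a} (Λ : List Loop) → RootedIn (v ∷ S) Λ → (P : a ⇝ v) → Absorption S Λ P
  absorb [] [] P = record
    { path = P ; remaining = [] ; rooted = [] ; length-≡ = refl ; ⊆-path = λ y∈ → y∈ ; onLoops⁻ = λ () }
  absorb ((_ , c) ∷ Λ) (here refl ∷ rooted) P = record
    { path      = path
    ; remaining = remaining
    ; rooted    = rooted′
    ; length-≡  = trans length-≡ (trans (cong (_+ ℓˡ Λ) (ℓ-++ P c)) (+-assoc (ℓ P) (ℓ c) (ℓˡ Λ)))
    ; ⊆-path    = ⊆-path ∘ ∈-++⁺ˡ P c
    ; onLoops⁻  = λ { (here y∈c) → inj₁ (⊆-path (∈-++⁺ʳ P c y∈c)) ; (there y∈Λ) → onLoops⁻ y∈Λ }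
    }
    where open Absorption (absorb Λ rooted (P ++ʷ c)) renaming (rooted to rooted′)
  absorb ((b , c) ∷ Λ) (there b∈S ∷ rooted) P = record
    { path      = path
    ; remaining = (b , c) ∷ remaining
    ; rooted    = b∈S ∷ rooted′
    ; length-≡  = trans (x∙yz≈y∙xz (ℓ path) (ℓ c) (ℓˡ remaining))
                    (trans (cong (ℓ c +_) length-≡) (x∙yz≈y∙xz (ℓ c) (ℓ P) (ℓˡ Λ)))
    ; ⊆-path    = ⊆-path
    ; onLoops⁻  = λ { (here y∈c) → inj₂ (here y∈c) ; (there y∈Λ) → map₂ there (onLoops⁻ y∈Λ) }
    }
    where open Absorption (absorb Λ rooted P) renaming (rooted to rooted′)

  infixr 5 _▸_

  data Chain : Fin n → Fin n → Set where
    done : ∀ {a} → Chain a a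
    _▸_  : ∀ {a b c} → a ⇝ b → Chain b c → Chain a c

  junctions : ∀ {a c} → Chain a c → List (Fin n)
  junctions done = []
  junctions (_▸_ {a} _ ch) = a ∷ junctions ch

  ℓᶜ : ∀ {a c} → Chain a c → ℕ
  ℓᶜ done = 0
  ℓᶜ (w ▸ ch) = ℓ w + ℓᶜ ch

  evens odds : ∀ {a c} → Chain a c → List Segment
  evens done = []
  evens (_▸_ {a} {b} w ch) = (a , b , w) ∷ odds ch
  odds done = []
  odds (w ▸ ch) = evens ch

  ℓ-evens+odds : ∀ {a c} (ch : Chain a c) → ℓˢ (evens ch) + ℓˢ (odds ch) ≡ ℓᶜ ch
  ℓ-evens+odds done = refl
  ℓ-evens+odds (w ▸ ch) = trans (+-assoc (ℓ w) (ℓˢ (odds ch)) _)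
    (cong (ℓ w +_) (trans (+-comm (ℓˢ (odds ch)) _) (ℓ-evens+odds ch)))

  if-not : ∀ b {A : Set} (t e : A) → (if not b then t else e) ≡ (if b then e else t)
  if-not true t e = refl
  if-not false t e = refl

  endpoints-evens : ∀ {a c} (ch : Chain a c) x → endpoints (evens ch) x ≡
    multiplicity (junctions ch) x + (if isOdd (length (junctions ch)) then δ x c else 0)
  endpoints-odds : ∀ {a c} (ch : Chain a c) x → endpoints (odds ch) x + δ x a ≡
    multiplicity (junctions ch) x + (if isOdd (length (junctions ch)) then 0 else δ x c)
  endpoints-evens done x = refl
  endpoints-evens {c = c} (_▸_ {a} {b} w ch) x = begin
    δ x a + δ x b + endpoints (odds ch) x    ≡⟨ +-assoc (δ x a) (δ x b) _ ⟩
    δ x a + (δ x b + endpoints (odds ch) x)  ≡⟨ cong (δ x a +_) (trans (+-comm (δ x b) _) (endpoints-odds ch x)) ⟩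
    δ x a + (M + (if o then 0 else δ x c))   ≡⟨ +-assoc (δ x a) M _ ⟨
    δ x a + M + (if o then 0 else δ x c)     ≡⟨ cong (δ x a + M +_) (if-not o (δ x c) 0) ⟨
    δ x a + M + (if not o then δ x c else 0) ∎
    where
    open ≡-Reasoning
    M : ℕ
    M = multiplicity (junctions ch) x
    o : Bool
    o = isOdd (length (junctions ch))
  endpoints-odds done x = refl
  endpoints-odds {c = c} (_▸_ {a} w ch) x = begin
    endpoints (evens ch) x + δ x a           ≡⟨ +-comm _ (δ x a) ⟩
    δ x a + endpoints (evens ch) x           ≡⟨ cong (δ x a +_) (endpoints-evens ch x) ⟩
    δ x a + (M + (if o then δ x c else 0))   ≡⟨ +-assoc (δ x a) M _ ⟨
    δ x a + M + (if o then δ x c else 0)     ≡⟨ cong (δ x a + M +_) (if-not o 0 (δ x c)) ⟨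
    δ x a + M + (if not o then 0 else δ x c) ∎
    where
    open ≡-Reasoning
    M : ℕ
    M = multiplicity (junctions ch) x
    o : Bool
    o = isOdd (length (junctions ch))

  endpoints-evenClosedChain : ∀ {o} (ch : Chain o o) → isOdd (length (junctions ch)) ≡ false →
    ∀ x → endpoints (evens ch) x ≡ multiplicity (junctions ch) x × endpoints (odds ch) x ≡ multiplicity (junctions ch) x
  endpoints-evenClosedChain {o} ch even x =
    trans (endpoints-evens ch x) (trans (cong (λ b → M + (if b then δ x o else 0)) even) (+-identityʳ M)) ,
    +-cancelʳ-≡ (δ x o) _ M (trans (endpoints-odds ch x) (cong (λ b → M + (if b then 0 else δ x o)) even))
    where
    M : ℕ
    M = multiplicity (junctions ch) x

module TreeTour {n : ℕ} (G T : Graph n) (T⊆G : Subgraph T G) (acyclic : Acyclic T) where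
  open import Defs hiding (sym)
  open Counting
  open import Data.Empty using (⊥-elim)
  open import Data.Fin using (Fin; _≟_)
  open import Data.List using (List; []; _∷_)
  open import Data.List.Membership.Propositional using (_∈_; _∉_)
  open import Data.List.Relation.Binary.Subset.Propositional using (_⊆_)
  open import Data.List.Relation.Unary.All using ([]; _∷_)
  open import Data.List.Relation.Unary.Any using (here; there)
  open import Data.Nat using (ℕ; zero; suc; _+_; _≤_; s≤s; z≤n)
  open import Data.Nat.Tactic.RingSolver using (solve-∀)
  open import Data.Nat.Properties using (+-comm; +-assoc; +-identityʳ; +-suc; suc-injective; m+n≡0⇒m≡0; m+n≡0⇒n≡0; +-commutativeSemigroup)
  open import Algebra.Properties.CommutativeSemigroup +-commutativeSemigroup using (x∙yz≈y∙xz; x∙yz≈yx∙z)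
  open import Data.Product using (Σ; _×_; _,_; proj₁; proj₂)
  open import Data.Sum using (_⊎_; inj₁; inj₂)
  open import Function using (_∘_)
  open import Relation.Binary.PropositionalEquality
  open import Relation.Nullary using (yes; no)
  open Walks G
  open Segments G
  open OddVertices T
  open Tree T using (Growth; root; attach; attachments; attached-is-leaf)

  +1+≡1 : ∀ a b → a + 1 + b ≡ 1 → a + b ≡ 0
  +1+≡1 a b eq = suc-injective (trans (cong (_+ b) (+-comm 1 a)) eq)

  +≡0⇒≡ : ∀ a b → a + b ≡ 0 → a ≡ b
  +≡0⇒≡ a b eq = trans (m+n≡0⇒m≡0 a eq) (sym (m+n≡0⇒n≡0 a eq))

  split-middle : ∀ a c d e → a + (c + d + e) ≡ a + c + e + d
  split-middle = solve-∀

  pull-one : ∀ a l r → a + 1 + (l + r) ≡ suc (l + (a + r))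
  pull-one = solve-∀

  data Position (v p x : Fin n) : Set where
    at-leaf   : x ≡ v → Position v p x
    at-parent : x ≡ p → Position v p x
    elsewhere : x ≢ v → x ≢ p → Position v p x

  position : ∀ v p x → Position v p x
  position v p x with x ≟ v | x ≟ p
  ... | yes x≡v | _ = at-leaf x≡v
  ... | no _ | yes x≡p = at-parent x≡p
  ... | no x≢v | no x≢p = elsewhere x≢v x≢p

  -- J and the tree edges already peeled off, regrouped into walks whose free ends are the
  -- odd-degree vertices of the subtree on S.
  record Decomposition (S : List (Fin n)) : Set where
    constructor decomposition
    field
      segments      : List Segment
      loops         : List Loop
      endpoints≡odd : ∀ x → endpoints segments x ≡ oddIn S x
      rooted        : RootedIn S loops

    weight : ℕ
    weight = ℓˢ segments + ℓˡ loops

    Covers : Fin n → Set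
    Covers y = OnSegments segments y ⊎ OnLoops loops y

  open Decomposition

  module _ {S v p} (v∉ : v ∉ S) (p∈ : p ∈ S) (vp : Adj T v p)
           (leaf : ∀ {x} → x ∈ S → Adj T v x → x ≡ p) where
    open Leaf v∉ p∈ vp leaf

    p≢v : p ≢ v
    p≢v refl = v∉ p∈

    module AfterExtraction {a} (L₁ : List Segment) (removed : ∀ x → δ x a + δ x v + endpoints L₁ x ≡ oddIn (v ∷ S) x) where

      endpoints-at-leaf : δ v a + endpoints L₁ v ≡ 0
      endpoints-at-leaf = +1+≡1 (δ v a) (endpoints L₁ v)
        (trans (cong (λ d → δ v a + d + endpoints L₁ v) (sym (δ-refl v))) (trans (removed v) oddIn-leaf))

      endpoints-at-parent : δ p a + endpoints L₁ p + oddIn S p ≡ 1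
      endpoints-at-parent = trans (cong (_+ oddIn S p) (trans (cong (_+ endpoints L₁ p) drop-δpv) (removed p))) oddIn-parent
        where
        drop-δpv : δ p a ≡ δ p a + δ p v
        drop-δpv = sym (trans (cong (δ p a +_) (δ-≢ p≢v)) (+-identityʳ (δ p a)))

      endpoints-elsewhere : ∀ {x} → x ≢ v → x ≢ p → δ x a + endpoints L₁ x ≡ oddIn S x
      endpoints-elsewhere {x} x≢v x≢p =
        trans (cong (_+ endpoints L₁ x) drop-δxv) (trans (removed x) (oddIn-elsewhere x≢v x≢p))
        where
        drop-δxv : δ x a ≡ δ x a + δ x v
        drop-δxv = sym (trans (cong (δ x a +_) (δ-≢ x≢v)) (+-identityʳ (δ x a)))

      Reattachment : a ⇝ p → List Loop → Set
      Reattachment P Λ₁ = Σ (Decomposition S) λ D →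
        weight D ≡ ℓ P + (ℓˢ L₁ + ℓˡ Λ₁) ×
        (∀ {y} → y ∈ vertices P ⊎ OnSegments L₁ y ⊎ OnLoops Λ₁ y → Covers D y)

      closeLoop : a ≡ p → (P : a ⇝ p) (Λ₁ : List Loop) → RootedIn S Λ₁ → Reattachment P Λ₁
      closeLoop refl P Λ₁ rooted₁ =
        record { segments = L₁ ; loops = (a , P) ∷ Λ₁ ; endpoints≡odd = invariant ; rooted = p∈ ∷ rooted₁ } ,
        x∙yz≈y∙xz (ℓˢ L₁) (ℓ P) (ℓˡ Λ₁) ,
        λ { (inj₁ y∈P)          → inj₂ (here y∈P)
          ; (inj₂ (inj₁ y∈L₁)) → inj₁ y∈L₁
          ; (inj₂ (inj₂ y∈Λ₁)) → inj₂ (there y∈Λ₁) }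
        where
        invariant : ∀ x → endpoints L₁ x ≡ oddIn S x
        invariant x with position v p x
        ... | at-leaf refl = trans (m+n≡0⇒n≡0 (δ v a) endpoints-at-leaf) (sym (oddIn-∉ {S} v∉))
        ... | at-parent refl = +≡0⇒≡ _ _ (suc-injective (trans (cong (λ d → d + endpoints L₁ x + oddIn S x) (sym (δ-refl x))) endpoints-at-parent))
        ... | elsewhere x≢v x≢p = trans (cong (_+ endpoints L₁ x) (sym (δ-≢ x≢p))) (endpoints-elsewhere x≢v x≢p)

      appendSegment : a ≢ p → endpoints L₁ p ≡ 0 → (P : a ⇝ p) (Λ₁ : List Loop) → RootedIn S Λ₁ → Reattachment P Λ₁
      appendSegment a≢p E₁p≡0 P Λ₁ rooted₁ =
        record { segments = (a , p , P) ∷ L₁ ; loops = Λ₁ ; endpoints≡odd = invariant ; rooted = rooted₁ } ,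
        +-assoc (ℓ P) (ℓˢ L₁) (ℓˡ Λ₁) ,
        λ { (inj₁ y∈P)          → inj₁ (here y∈P)
          ; (inj₂ (inj₁ y∈L₁)) → inj₁ (there y∈L₁)
          ; (inj₂ (inj₂ y∈Λ₁)) → inj₂ y∈Λ₁ }
        where
        invariant : ∀ x → δ x a + δ x p + endpoints L₁ x ≡ oddIn S x
        invariant x with position v p x
        ... | at-leaf refl = trans (δ-drop (p≢v ∘ sym) (δ x a) _) (trans endpoints-at-leaf (sym (oddIn-∉ {S} v∉)))
        ... | at-parent refl = begin
          δ x a + δ x x + endpoints L₁ x   ≡⟨ cong₂ (λ d e → d + δ x x + e) (δ-≢ (a≢p ∘ sym)) E₁p≡0 ⟩
          δ x x + 0                        ≡⟨ cong (_+ 0) (δ-refl x) ⟩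
          1                                ≡⟨ endpoints-at-parent ⟨
          δ x a + endpoints L₁ x + oddIn S x ≡⟨ cong₂ (λ d e → d + e + oddIn S x) (δ-≢ (a≢p ∘ sym)) E₁p≡0 ⟩
          oddIn S x                        ∎
          where open ≡-Reasoning
        ... | elsewhere x≢v x≢p = trans (δ-drop x≢p (δ x a) _) (endpoints-elsewhere x≢v x≢p)

      mergeSegments : a ≢ p → 1 ≤ endpoints L₁ p → (P : a ⇝ p) (Λ₁ : List Loop) → RootedIn S Λ₁ → Reattachment P Λ₁
      mergeSegments a≢p E₁p≥1 P Λ₁ rooted₁ =
        record { segments = merged ∷ others ; loops = Λ₁ ; endpoints≡odd = invariant ; rooted = rooted₁ } ,
        weight-≡ ,
        λ { (inj₁ y∈P)          → inj₁ (here (∈-++⁺ˡ P _ y∈P))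
          ; (inj₂ (inj₁ y∈L₁)) → covers-L₁ (onSegments⁻ y∈L₁)
          ; (inj₂ (inj₂ y∈Λ₁)) → inj₂ y∈Λ₁ }
        where
        open Extraction (extract L₁ p E₁p≥1)
        merged : Segment
        merged = a , source , P ++ʷ reverse path
        covers-L₁ : ∀ {y} → y ∈ vertices path ⊎ OnSegments others y → OnSegments (merged ∷ others) y ⊎ OnLoops Λ₁ y
        covers-L₁ (inj₁ y∈Q) = inj₁ (here (∈-++⁺ʳ P _ (∈-reverse⁺ path y∈Q)))
        covers-L₁ (inj₂ y∈L₃) = inj₁ (there y∈L₃)
        weight-≡ : ℓ (P ++ʷ reverse path) + ℓˢ others + ℓˡ Λ₁ ≡ ℓ P + (ℓˢ L₁ + ℓˡ Λ₁)
        weight-≡ = begin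
          ℓ (P ++ʷ reverse path) + ℓˢ others + ℓˡ Λ₁
            ≡⟨ cong (λ m → m + ℓˢ others + ℓˡ Λ₁) (trans (ℓ-++ P _) (cong (ℓ P +_) (ℓ-reverse path))) ⟩
          ℓ P + ℓ path + ℓˢ others + ℓˡ Λ₁
            ≡⟨ trans (+-assoc (ℓ P + ℓ path) _ _) (+-assoc (ℓ P) (ℓ path) _) ⟩
          ℓ P + (ℓ path + (ℓˢ others + ℓˡ Λ₁))
            ≡⟨ cong (ℓ P +_) (trans (sym (+-assoc (ℓ path) (ℓˢ others) _)) (cong (_+ ℓˡ Λ₁) (sym length-≡))) ⟩
          ℓ P + (ℓˢ L₁ + ℓˡ Λ₁)
            ∎
          where open ≡-Reasoning
        X : Fin n → ℕ
        X x = δ x a + δ x source + endpoints others x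
        regroup : ∀ x → δ x a + endpoints L₁ x ≡ X x + δ x p
        regroup x = trans (cong (δ x a +_) (endpoints-≡ x)) (split-middle (δ x a) (δ x source) (δ x p) (endpoints others x))
        invariant : ∀ x → X x ≡ oddIn S x
        invariant x with position v p x
        ... | at-leaf refl = trans (m+n≡0⇒m≡0 _ (trans (sym (regroup x)) endpoints-at-leaf)) (sym (oddIn-∉ {S} v∉))
        ... | at-parent refl = +≡0⇒≡ (X x) (oddIn S x) (+1+≡1 (X x) (oddIn S x) (begin
          X x + 1 + oddIn S x                  ≡⟨ cong (λ d → X x + d + oddIn S x) (δ-refl x) ⟨
          X x + δ x x + oddIn S x              ≡⟨ cong (_+ oddIn S x) (regroup x) ⟨
          δ x a + endpoints L₁ x + oddIn S x   ≡⟨ endpoints-at-parent ⟩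
          1                                    ∎))
          where open ≡-Reasoning
        ... | elsewhere x≢v x≢p = begin
          X x                       ≡⟨ +-identityʳ (X x) ⟨
          X x + 0                   ≡⟨ cong (X x +_) (δ-≢ x≢p) ⟨
          X x + δ x p               ≡⟨ regroup x ⟨
          δ x a + endpoints L₁ x    ≡⟨ endpoints-elsewhere x≢v x≢p ⟩
          oddIn S x                 ∎
          where open ≡-Reasoning

    -- The segment ending at the leaf v swallows the loops based at v and continues along the tree
    -- edge to p; there it closes up, is joined to the segment ending at p, or becomes a new segment.
    peel : (D : Decomposition (v ∷ S)) → Σ (Decomposition S) λ D′ →
           weight D′ ≡ suc (weight D) × (∀ {y} → Covers D y → Covers D′ y) × Covers D′ v
    peel D = D′ , weight-≡ , (covers ∘ covers-old) , covers (inj₁ (∈-++⁺ˡ A.path _ (target∈ A.path)))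
      where
      module E = Extraction (extract (segments D) v (subst (1 ≤_) (sym (trans (endpoints≡odd D v) oddIn-leaf)) (s≤s z≤n)))
      module A = Absorption (absorb (loops D) (rooted D) E.path)
      P : E.source ⇝ p
      P = A.path ++ʷ edge (T⊆G v p vp)
      open AfterExtraction E.others (λ x → trans (sym (E.endpoints-≡ x)) (endpoints≡odd D x))
      reattached : Reattachment P A.remaining
      reattached with E.source ≟ p | endpoints E.others p in E₁p
      ... | yes a≡p | _ = closeLoop a≡p P A.remaining A.rooted
      ... | no a≢p | zero = appendSegment a≢p E₁p P A.remaining A.rooted
      ... | no a≢p | suc _ = mergeSegments a≢p (subst (1 ≤_) (sym E₁p) (s≤s z≤n)) P A.remaining A.rooted
      D′ : Decomposition S
      D′ = proj₁ reattached
      covers : ∀ {y} → y ∈ vertices P ⊎ OnSegments E.others y ⊎ OnLoops A.remaining y → Covers D′ y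
      covers = proj₂ (proj₂ reattached)
      covers-old : ∀ {y} → Covers D y → y ∈ vertices P ⊎ OnSegments E.others y ⊎ OnLoops A.remaining y
      covers-old (inj₁ y∈segments) with E.onSegments⁻ y∈segments
      ... | inj₁ y∈path = inj₁ (∈-++⁺ˡ A.path _ (A.⊆-path y∈path))
      ... | inj₂ y∈others = inj₂ (inj₁ y∈others)
      covers-old (inj₂ y∈loops) with A.onLoops⁻ y∈loops
      ... | inj₁ y∈path = inj₁ (∈-++⁺ˡ A.path _ y∈path)
      ... | inj₂ y∈remaining = inj₂ (inj₂ y∈remaining)
      weight-≡ : weight D′ ≡ suc (weight D)
      weight-≡ = begin
        weight D′                                            ≡⟨ proj₁ (proj₂ reattached) ⟩
        ℓ P + (ℓˢ E.others + ℓˡ A.remaining)                 ≡⟨ cong (_+ (ℓˢ E.others + ℓˡ A.remaining)) (ℓ-++ A.path _) ⟩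
        ℓ A.path + 1 + (ℓˢ E.others + ℓˡ A.remaining)        ≡⟨ pull-one (ℓ A.path) (ℓˢ E.others) (ℓˡ A.remaining) ⟩
        suc (ℓˢ E.others + (ℓ A.path + ℓˡ A.remaining))      ≡⟨ cong (λ m → suc (ℓˢ E.others + m)) A.length-≡ ⟩
        suc (ℓˢ E.others + (ℓ E.path + ℓˡ (loops D)))        ≡⟨ cong suc (x∙yz≈yx∙z (ℓˢ E.others) (ℓ E.path) _) ⟩
        suc (ℓ E.path + ℓˢ E.others + ℓˡ (loops D))          ≡⟨ cong (λ m → suc (m + ℓˡ (loops D))) E.length-≡ ⟨
        suc (weight D)                                       ∎
        where open ≡-Reasoning

  module _ (r : Fin n) where

    concatLoops : (Λ : List Loop) → RootedIn (r ∷ []) Λ →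
                  Σ (r ⇝ r) λ t → ℓ t ≡ ℓˡ Λ × r ∈ vertices t × (∀ {y} → OnLoops Λ y → y ∈ vertices t)
    concatLoops [] [] = [ r ] , refl , here refl , λ ()
    concatLoops ((_ , c) ∷ Λ) (here refl ∷ rooted) with concatLoops Λ rooted
    ... | t , ℓ-≡ , r∈t , covers = c ++ʷ t , trans (ℓ-++ c t) (cong (ℓ c +_) ℓ-≡) , ∈-++⁺ʳ c t r∈t ,
          λ { (here y∈c) → ∈-++⁺ˡ c t y∈c ; (there y∈Λ) → ∈-++⁺ʳ c t (covers y∈Λ) }

    tourOf : ∀ {S} (g : Growth r S) (D : Decomposition S) →
             Σ (r ⇝ r) λ t → ℓ t ≡ weight D + attachments r g × (∀ {y} → y ∈ S ⊎ Covers D y → y ∈ vertices t)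
    tourOf root (decomposition [] Λ _ rooted) with concatLoops Λ rooted
    ... | t , ℓ-≡ , r∈t , covers = t , trans ℓ-≡ (sym (+-identityʳ (ℓˡ Λ))) ,
          λ { (inj₁ (here refl)) → r∈t ; (inj₂ (inj₂ y∈Λ)) → covers y∈Λ }
    tourOf root (decomposition ((a , b , _) ∷ L) _ endpoints≡odd _) =
      ⊥-elim (suc≢0 (trans (cong (λ d → d + δ a b + endpoints L a) (sym (δ-refl a))) (trans (endpoints≡odd a) (oddIn-root r a))))
      where
      suc≢0 : ∀ {m} → suc m ≢ 0
      suc≢0 ()
    tourOf (attach v p g v∉ p∈ vp) D =
      let D′ , weight-≡ , covers-D , covers-v = peel v∉ p∈ vp (attached-is-leaf r acyclic g v∉ p∈ vp) D
          t , ℓ-≡ , covers = tourOf g D′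
      in t , trans ℓ-≡ (trans (cong (_+ attachments r g) weight-≡) (sym (+-suc (weight D) _))) ,
         λ { (inj₁ (here refl))  → covers (inj₂ covers-v)
           ; (inj₁ (there y∈S)) → covers (inj₁ y∈S)
           ; (inj₂ c)           → covers (inj₂ (covers-D c)) }

    treeTour : ∀ {S} (g : Growth r S) → (∀ y → y ∈ S) →
               (J : List Segment) → (∀ x → endpoints J x ≡ 𝟙ᵇ (isOdd (degree T x))) →
               Σ (r ⇝ r) λ t → Spans t × ℓ t ≡ ℓˢ J + attachments r g
    treeTour g spanning J J-odd with tourOf g (decomposition J [] (λ x → trans (J-odd x) (sym (oddIn-complete spanning x))) [])
    ... | t , ℓ-≡ , covers = t , (λ y → covers (inj₁ (spanning y))) , trans ℓ-≡ (cong (_+ attachments r g) (+-identityʳ (ℓˢ J)))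

module TJoin {n : ℕ} (G : Graph n) (marked : Fin n → Bool) where
  open import Defs hiding (sym)
  open Counting
  open import Data.Bool using (Bool; true; false)
  import Data.Bool as Bool
  open import Data.Empty using (⊥-elim)
  open import Data.Fin using (Fin; _≟_)
  open import Data.Fin.Properties using (any?)
  open import Data.List using (List; []; _∷_; length)
  open import Data.List.Membership.Propositional using (_∈_; _∉_)
  open import Data.List.Relation.Unary.All using ([])
  open import Data.List.Relation.Unary.All.Properties using (¬Any⇒All¬)
  open import Data.List.Relation.Unary.AllPairs using ([]; _∷_)
  open import Data.List.Relation.Unary.Any using (here; there)
  open import Data.List.Relation.Unary.Unique.Propositional using (Unique)
  open import Data.Nat using (ℕ; _+_; _*_; _≤_; _≤?_; z≤n)
  open import Data.Nat.Properties using (+-assoc; +-comm; +-identityʳ; +-monoʳ-≤; ≤-trans; ≤-reflexive; ≰⇒>; <⇒≤; +-0-commutativeMonoid)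
  open import Algebra.Properties.CommutativeMonoid.Sum +-0-commutativeMonoid
    using (sum-syntax; sum-cong-≗) renaming (sum to ∑)
  open import Data.Product using (Σ; _×_; _,_; proj₁; proj₂)
  open import Data.Sum using (_⊎_; inj₁; inj₂; [_,_]′)
  open import Function using (_∘_; _⇔_; mk⇔)
  open import Relation.Binary.PropositionalEquality hiding (J)
  open import Relation.Nullary using (yes; no; ¬_; ¬?; _×-dec_)
  open import Relation.Nullary.Decidable using (decidable-stable)
  open Walks G
  open Segments G
  open import Data.List.Membership.DecPropositional (_≟_ {n}) using (_∈?_)

  Marked : Fin n → Set
  Marked y = marked y ≡ true

  -- R is cut at the first visit of every marked vertex outside K; seg is the already traversed
  -- part of the current piece.
  record FirstVisits (K : List (Fin n)) {m x o} (seg : m ⇝ x) (R : x ⇝ o) : Set where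
    field
      chain    : Chain m o
      ℓ-≡      : ℓᶜ chain ≡ ℓ seg + ℓ R
      unique   : Unique (junctions chain)
      head∈    : m ∈ junctions chain
      fresh    : ∀ {j} → j ∈ junctions chain → Marked j × j ∉ K
      complete : ∀ {y} → Marked y → y ∈ vertices R → y ∈ K ⊎ y ∈ junctions chain

    seen : ∀ {y} → y ∈ m ∷ K → y ∈ K ⊎ y ∈ junctions chain
    seen (here refl) = inj₂ head∈
    seen (there y∈K) = inj₁ y∈K

  chop : ∀ {m x o} (K : List (Fin n)) (seg : m ⇝ x) (R : x ⇝ o) →
         Marked m → m ∉ K → (Marked x → x ∈ m ∷ K) → FirstVisits K seg R
  chop {m} K seg [ _ ] m-marked m∉K x-seen = record
    { chain    = seg ▸ done
    ; ℓ-≡      = refl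
    ; unique   = [] ∷ []
    ; head∈    = here refl
    ; fresh    = λ { (here refl) → m-marked , m∉K }
    ; complete = λ { y-marked (here refl) → seen′ (x-seen y-marked) }
    }
    where
    seen′ : ∀ {y} → y ∈ m ∷ K → y ∈ K ⊎ y ∈ m ∷ []
    seen′ (here y≡m) = inj₂ (here y≡m)
    seen′ (there y∈K) = inj₁ y∈K
  chop {m} K seg (_∷ʷ_ {v = x′} e R) m-marked m∉K x-seen with (marked x′ Bool.≟ true) ×-dec (¬? (x′ ∈? m ∷ K))
  ... | yes (x′-marked , x′∉) = record
    { chain    = seg′ ▸ chain
    ; ℓ-≡      = trans (cong₂ _+_ (ℓ-++ seg (edge e)) ℓ-≡) (+-assoc (ℓ seg) 1 (ℓ R))
    ; unique   = ¬Any⇒All¬ _ (λ m∈ → proj₂ (fresh m∈) (here refl)) ∷ unique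
    ; head∈    = here refl
    ; fresh    = λ { (here refl) → m-marked , m∉K ; (there j∈) → proj₁ (fresh j∈) , proj₂ (fresh j∈) ∘ there }
    ; complete = λ { y-marked (here refl) → lift (inj₁ (x-seen y-marked)) ; y-marked (there y∈R) → lift (complete y-marked y∈R) }
    }
    where
    seg′ : m ⇝ x′
    seg′ = seg ++ʷ edge e
    open FirstVisits (chop (m ∷ K) [ x′ ] R x′-marked x′∉ (λ _ → here refl))
    lift : ∀ {y} → y ∈ m ∷ K ⊎ y ∈ junctions chain → y ∈ K ⊎ y ∈ junctions (seg′ ▸ chain)
    lift (inj₁ (here y≡m)) = inj₂ (here y≡m)
    lift (inj₁ (there y∈K)) = inj₁ y∈K
    lift (inj₂ y∈chain) = inj₂ (there y∈chain)
  ... | no not-new = record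
    { chain    = chain
    ; ℓ-≡      = trans ℓ-≡ (trans (cong (_+ ℓ R) (ℓ-++ seg (edge e))) (+-assoc (ℓ seg) 1 (ℓ R)))
    ; unique   = unique
    ; head∈    = head∈
    ; fresh    = fresh
    ; complete = λ { y-marked (here refl) → seen (x-seen y-marked) ; y-marked (there y∈R) → complete y-marked y∈R }
    }
    where
    x′-seen : Marked x′ → x′ ∈ m ∷ K
    x′-seen x′-marked = decidable-stable (x′ ∈? m ∷ K) (λ x′∉ → not-new (x′-marked , x′∉))
    open FirstVisits (chop K (seg ++ʷ edge e) R m-marked m∉K x′-seen)

  shorter : (A B : List Segment) → Σ (List Segment) λ J → (J ≡ A ⊎ J ≡ B) × 2 * ℓˢ J ≤ ℓˢ A + ℓˢ B
  shorter A B with ℓˢ A ≤? ℓˢ B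
  ... | yes A≤B = A , inj₁ refl , +-monoʳ-≤ (ℓˢ A) (≤-trans (≤-reflexive (+-identityʳ (ℓˢ A))) A≤B)
  ... | no A≰B = B , inj₂ refl , subst (2 * ℓˢ B ≤_) (+-comm (ℓˢ B) (ℓˢ A))
                   (+-monoʳ-≤ (ℓˢ B) (≤-trans (≤-reflexive (+-identityʳ (ℓˢ B))) (<⇒≤ (≰⇒> A≰B))))

  𝟙-≟-true : ∀ b → 𝟙 (b Bool.≟ true) ≡ 𝟙ᵇ b
  𝟙-≟-true true = refl
  𝟙-≟-true false = refl

  module _ (even : isOdd (∑[ y < n ] 𝟙ᵇ (marked y)) ≡ false) where

    -- There are as many pieces as odd vertices, an even number, so alternate pieces form two
    -- T-joins whose lengths add up to ℓ(R).
    joinFromClosedWalk : ∀ {o} → Marked o → (R : o ⇝ o) → (∀ y → Marked y → y ∈ vertices R) →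
                         Σ (List Segment) λ J → (∀ x → endpoints J x ≡ 𝟙ᵇ (marked x)) × 2 * ℓˢ J ≤ ℓ R
    joinFromClosedWalk o-marked R visits = J , endpoints-J J≡ , ≤-trans J-short (≤-reflexive (trans (ℓ-evens+odds chain) ℓ-≡))
      where
      open FirstVisits (chop [] [ _ ] R o-marked (λ ()) (λ _ → here refl))
      member : ∀ x → x ∈ junctions chain ⇔ Marked x
      member x = mk⇔ (proj₁ ∘ fresh) (λ x-marked → [ (λ ()) , (λ x∈ → x∈) ]′ (complete x-marked (visits x x-marked)))
      𝟙-junction : ∀ x → 𝟙 (x ∈? junctions chain) ≡ 𝟙ᵇ (marked x)
      𝟙-junction x = trans (𝟙-cong (x ∈? junctions chain) (marked x Bool.≟ true) (member x)) (𝟙-≟-true (marked x))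
      even-junctions : isOdd (length (junctions chain)) ≡ false
      even-junctions = trans (cong isOdd (trans (sym (count-unique unique)) (sum-cong-≗ 𝟙-junction))) even
      multiplicity≡ : ∀ x → multiplicity (junctions chain) x ≡ 𝟙ᵇ (marked x)
      multiplicity≡ x = trans (multiplicity-unique unique x) (𝟙-junction x)
      endpoints-J : ∀ {K} → K ≡ evens chain ⊎ K ≡ odds chain → ∀ x → endpoints K x ≡ 𝟙ᵇ (marked x)
      endpoints-J (inj₁ refl) x = trans (proj₁ (endpoints-evenClosedChain chain even-junctions x)) (multiplicity≡ x)
      endpoints-J (inj₂ refl) x = trans (proj₂ (endpoints-evenClosedChain chain even-junctions x)) (multiplicity≡ x)
      J : List Segment
      J = proj₁ (shorter (evens chain) (odds chain))
      J≡ : J ≡ evens chain ⊎ J ≡ odds chain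
      J≡ = proj₁ (proj₂ (shorter (evens chain) (odds chain)))
      J-short : 2 * ℓˢ J ≤ ℓˢ (evens chain) + ℓˢ (odds chain)
      J-short = proj₂ (proj₂ (shorter (evens chain) (odds chain)))

    joinFromWalk : ∀ {u} (C : u ⇝ u) → (∀ y → Marked y → y ∈ vertices C) →
                   Σ (List Segment) λ J → (∀ x → endpoints J x ≡ 𝟙ᵇ (marked x)) × 2 * ℓˢ J ≤ ℓ C
    joinFromWalk C visits with any? (λ y → marked y Bool.≟ true)
    ... | no none = [] , unmarked , z≤n
      where
      unmarked : ∀ x → 0 ≡ 𝟙ᵇ (marked x)
      unmarked x with marked x in x-mark
      ... | true = ⊥-elim (none (x , x-mark))
      ... | false = refl
    ... | yes (o , o-marked) with rotate C (visits o o-marked)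
    ...   | R , ℓR≡ℓC , C⊆R with joinFromClosedWalk o-marked R (λ y y-marked → C⊆R (visits y y-marked))
    ...     | J , endpoints-J , J-short = J , endpoints-J , subst (2 * ℓˢ J ≤_) ℓR≡ℓC J-short

module RationalBounds where
  open import Defs using (toℚ)
  open import Data.Integer as ℤ using (+_)
  import Data.Integer.Properties as ℤ
  open import Data.Nat as ℕ using (ℕ)
  import Data.Nat.Properties as ℕₚ
  open import Data.Nat.Divisibility using (∣1⇒≡1)
  open import Data.Product using (_,_)
  open import Data.Rational using (ℚ; mkℚ; 0ℚ; 1ℚ; _≤_; _<_; _+_; _*_; _-_; -_; toℚᵘ; nonNegative)
  open import Data.Rational.Properties
  open import Data.Rational.Solver using (module +-*-Solver)
  import Data.Rational.Unnormalised as ℚᵘ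
  import Data.Rational.Unnormalised.Properties as ℚᵘ
  open import Data.Sum using (_⊎_; inj₁; inj₂; map)
  open import Relation.Binary.PropositionalEquality
  open +-*-Solver

  toℚ≡mkℚ : ∀ k → toℚ k ≡ mkℚ (+ k) 0 (λ (_ , d∣1) → ∣1⇒≡1 d∣1)
  toℚ≡mkℚ k = normalize-coprime _

  toℚᵘ-toℚ : ∀ k → toℚᵘ (toℚ k) ≡ ℚᵘ.mkℚᵘ (+ k) 0
  toℚᵘ-toℚ k = cong toℚᵘ (toℚ≡mkℚ k)

  toℚ-+ : ∀ a b → toℚ (a ℕ.+ b) ≡ toℚ a + toℚ b
  toℚ-+ a b = toℚᵘ-injective (begin
    toℚᵘ (toℚ (a ℕ.+ b))                               ≡⟨ toℚᵘ-toℚ (a ℕ.+ b) ⟩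
    ℚᵘ.mkℚᵘ (+ (a ℕ.+ b)) 0                            ≈⟨ ℚᵘ.*≡* numerators ⟩
    ℚᵘ.mkℚᵘ (+ a) 0 ℚᵘ.+ ℚᵘ.mkℚᵘ (+ b) 0               ≡⟨ cong₂ ℚᵘ._+_ (toℚᵘ-toℚ a) (toℚᵘ-toℚ b) ⟨
    toℚᵘ (toℚ a) ℚᵘ.+ toℚᵘ (toℚ b)                     ≈⟨ toℚᵘ-homo-+ (toℚ a) (toℚ b) ⟨
    toℚᵘ (toℚ a + toℚ b)                               ∎)
    where
    open ℚᵘ.≃-Reasoning
    numerators : + (a ℕ.+ b) ℤ.* + 1 ≡ (+ a ℤ.* + 1 ℤ.+ + b ℤ.* + 1) ℤ.* + 1
    numerators = trans (ℤ.*-identityʳ _) (trans (ℤ.pos-+ a b)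
      (sym (trans (ℤ.*-identityʳ _) (cong₂ ℤ._+_ (ℤ.*-identityʳ (+ a)) (ℤ.*-identityʳ (+ b))))))

  toℚ-mono-≤ : ∀ {a b} → a ℕ.≤ b → toℚ a ≤ toℚ b
  toℚ-mono-≤ {a} {b} a≤b = toℚᵘ-cancel-≤ (subst₂ ℚᵘ._≤_ (sym (toℚᵘ-toℚ a)) (sym (toℚᵘ-toℚ b))
    (ℚᵘ.*≤* (subst₂ ℤ._≤_ (sym (ℤ.*-identityʳ (+ a))) (sym (ℤ.*-identityʳ (+ b))) (ℤ.+≤+ a≤b))))

  toℚ-2* : ∀ k → toℚ (2 ℕ.* k) ≡ toℚ k + toℚ k
  toℚ-2* k = trans (toℚ-+ k (k ℕ.+ 0)) (cong (λ m → toℚ k + toℚ m) (ℕₚ.+-identityʳ k))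

  toℚ-4* : ∀ k → toℚ (4 ℕ.* k) ≡ toℚ k + toℚ k + toℚ k + toℚ k
  toℚ-4* k = begin
    toℚ (4 ℕ.* k)                         ≡⟨ cong toℚ (ℕₚ.*-distribʳ-+ k 2 2) ⟩
    toℚ (2 ℕ.* k ℕ.+ 2 ℕ.* k)             ≡⟨ toℚ-+ (2 ℕ.* k) (2 ℕ.* k) ⟩
    toℚ (2 ℕ.* k) + toℚ (2 ℕ.* k)         ≡⟨ cong₂ _+_ (toℚ-2* k) (toℚ-2* k) ⟩
    toℚ k + toℚ k + (toℚ k + toℚ k)       ≡⟨ +-assoc (toℚ k + toℚ k) (toℚ k) (toℚ k) ⟨
    toℚ k + toℚ k + toℚ k + toℚ k         ∎
    where open ≡-Reasoning

  toℚ-+2* : ∀ a b → toℚ (a ℕ.+ 2 ℕ.* b) ≡ toℚ a + (toℚ b + toℚ b)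
  toℚ-+2* a b = trans (toℚ-+ a (2 ℕ.* b)) (cong (_+_ (toℚ a)) (toℚ-2* b))

  min-below-mix : ∀ {u w} (A B : ℚ) → 0ℚ ≤ u → 0ℚ ≤ w →
                  A * (u + w) ≤ u * A + w * B ⊎ B * (u + w) ≤ u * A + w * B
  min-below-mix {u} {w} A B 0≤u 0≤w with ≤-total A B
  ... | inj₁ A≤B = inj₁ (begin
    A * (u + w)       ≡⟨ solve 3 (λ a u w → a :* (u :+ w) := u :* a :+ w :* a) refl A u w ⟩
    u * A + w * A     ≤⟨ +-monoʳ-≤ (u * A) (*-monoˡ-≤-nonNeg w {{nonNegative 0≤w}} A≤B) ⟩
    u * A + w * B     ∎)
    where open ≤-Reasoning
  ... | inj₂ B≤A = inj₂ (begin
    B * (u + w)       ≡⟨ solve 3 (λ b u w → b :* (u :+ w) := u :* b :+ w :* b) refl B u w ⟩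
    u * B + w * B     ≤⟨ +-monoˡ-≤ (w * B) (*-monoˡ-≤-nonNeg u {{nonNegative 0≤u}} B≤A) ⟩
    u * A + w * B     ∎)
    where open ≤-Reasoning

  module _ {γ L K N : ℚ} (A B C : ℚ) (0≤γ : 0ℚ ≤ γ) (γ<3 : γ < toℚ 3) (0≤N : 0ℚ ≤ N)
           (h₁ : A + A ≤ L + (N + N)) (h₂ : B + (K + K) ≡ L + (N + N)) (h₃ : C ≤ N + N) (h₄ : L ≤ (1ℚ + γ) * K) where

    private
      F M u w : ℚ
      F = toℚ 3 - γ
      M = N + N + N + N
      u = 1ℚ - γ
      w = 1ℚ + γ

      0≤F : 0ℚ ≤ F
      0≤F = <⇒≤ (subst (_< F) (+-inverseʳ γ) (+-monoˡ-< (- γ) γ<3))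

      0≤w : 0ℚ ≤ w
      0≤w = ≤-trans (nonNegative⁻¹ 1ℚ) (+-monoʳ-≤ 1ℚ 0≤γ)

      0≤u : γ ≤ 1ℚ → 0ℚ ≤ u
      0≤u γ≤1 = subst (_≤ u) (+-inverseʳ γ) (+-monoˡ-≤ (- γ) γ≤1)

      weights≡F : u + u + w ≡ F
      weights≡F = solve 1 (λ g → (con 1ℚ :- g) :+ (con 1ℚ :- g) :+ (con 1ℚ :+ g) := con (toℚ 3) :- g) refl γ

      mix≤M : γ ≤ 1ℚ → (u + u) * A + w * B ≤ M
      mix≤M γ≤1 = begin
        (u + u) * A + w * B                   ≡⟨ cong₂ _+_ (solve 2 (λ u a → (u :+ u) :* a := u :* (a :+ a)) refl u A) wB≡ ⟩
        u * (A + A) + (w * X - w * (K + K))   ≤⟨ +-mono-≤ (*-monoˡ-≤-nonNeg u {{nonNegative (0≤u γ≤1)}} h₁)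
                                                           (+-monoʳ-≤ (w * X) (neg-antimono-≤ L+L≤)) ⟩
        u * X + (w * X - (L + L))             ≡⟨ solve 3 (λ g l n → (con 1ℚ :- g) :* (l :+ (n :+ n))
                                                                  :+ ((con 1ℚ :+ g) :* (l :+ (n :+ n)) :- (l :+ l))
                                                                  := n :+ n :+ n :+ n) refl γ L N ⟩
        M                                     ∎
        where
        open ≤-Reasoning
        X : ℚ
        X = L + (N + N)
        wB≡ : w * B ≡ w * X - w * (K + K)
        wB≡ = trans (solve 3 (λ w b k → w :* b := w :* (b :+ k) :- w :* k) refl w B (K + K)) (cong (λ z → w * z - w * (K + K)) h₂)
        L+L≤ : L + L ≤ w * (K + K)
        L+L≤ = ≤-trans (+-mono-≤ h₄ h₄) (≤-reflexive (solve 2 (λ w k → w :* k :+ w :* k := w :* (k :+ k)) refl w K))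

    oneOfThree : A * (toℚ 3 - γ) ≤ N + N + N + N ⊎ B * (toℚ 3 - γ) ≤ N + N + N + N ⊎ C * (toℚ 3 - γ) ≤ N + N + N + N
    oneOfThree with ≤-total γ 1ℚ
    ... | inj₂ 1≤γ = inj₂ (inj₂ (begin
      C * F              ≤⟨ *-monoʳ-≤-nonNeg F {{nonNegative 0≤F}} h₃ ⟩
      (N + N) * F        ≤⟨ *-monoˡ-≤-nonNeg (N + N) {{nonNegative (+-mono-≤ 0≤N 0≤N)}} F≤2 ⟩
      (N + N) * toℚ 2    ≡⟨ solve 1 (λ n → (n :+ n) :* con (toℚ 2) := n :+ n :+ n :+ n) refl N ⟩
      M                  ∎))
      where
      open ≤-Reasoning
      F≤2 : F ≤ toℚ 2
      F≤2 = +-monoʳ-≤ (toℚ 3) (neg-antimono-≤ 1≤γ)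
    ... | inj₁ γ≤1 with min-below-mix A B (+-mono-≤ (0≤u γ≤1) (0≤u γ≤1)) 0≤w
    ... | inj₁ A-below = inj₁ (subst (λ z → A * z ≤ M) weights≡F (≤-trans A-below (mix≤M γ≤1)))
    ... | inj₂ B-below = inj₂ (inj₁ (subst (λ z → B * z ≤ M) weights≡F (≤-trans B-below (mix≤M γ≤1))))

  ShortEnough : ℚ → ℕ → ℕ → Set
  ShortEnough γ n t = toℚ t * (toℚ 3 - γ) ≤ toℚ (4 ℕ.* n)

  oneOfThreeTours : ∀ {γ} → 0ℚ ≤ γ → γ < toℚ 3 → ∀ n l k a b c →
    2 ℕ.* a ℕ.≤ l ℕ.+ 2 ℕ.* n → b ℕ.+ 2 ℕ.* k ≡ l ℕ.+ 2 ℕ.* n → c ℕ.≤ 2 ℕ.* n → toℚ l ≤ (1ℚ + γ) * toℚ k →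
    ShortEnough γ n a ⊎ ShortEnough γ n b ⊎ ShortEnough γ n c
  oneOfThreeTours {γ} 0≤γ γ<3 n l k a b c h₁ h₂ h₃ h₄ =
    map (fits a) (map (fits b) (fits c)) (oneOfThree (toℚ a) (toℚ b) (toℚ c) 0≤γ γ<3 (toℚ-mono-≤ {0} {n} ℕ.z≤n) h₁′ h₂′ h₃′ h₄)
    where
    N : ℚ
    N = toℚ n
    fits : ∀ x → toℚ x * (toℚ 3 - γ) ≤ N + N + N + N → ShortEnough γ n x
    fits x = subst (toℚ x * (toℚ 3 - γ) ≤_) (sym (toℚ-4* n))
    h₁′ : toℚ a + toℚ a ≤ toℚ l + (N + N)
    h₁′ = subst₂ _≤_ (toℚ-2* a) (toℚ-+2* l n) (toℚ-mono-≤ h₁)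
    h₂′ : toℚ b + (toℚ k + toℚ k) ≡ toℚ l + (N + N)
    h₂′ = trans (sym (toℚ-+2* b k)) (trans (cong toℚ h₂) (toℚ-+2* l n))
    h₃′ : toℚ c ≤ N + N
    h₃′ = subst (toℚ c ≤_) (toℚ-2* n) (toℚ-mono-≤ h₃)

module Tours where
  open import Defs hiding (sym)
  open Counting
  open import Data.Bool using (true)
  open import Data.List.Membership.Propositional using (_∈_)
  open import Data.Nat using (ℕ; _+_; _*_; _≤_)
  open import Data.Nat.Properties using (module ≤-Reasoning; *-distribˡ-+; +-mono-≤; *-monoʳ-≤; <⇒≤; ≤-trans; ≤-reflexive; m≤m+n)
  open import Data.Product using (Σ; _×_; _,_)
  open import Function using (_∘_)
  open import Relation.Binary.PropositionalEquality

  module _ {n : ℕ} (G : Graph n) where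
    open Walks G

    tourThrough : ∀ u → Connected G → Σ (u ⇝ u) λ t → Spans t × ℓ t ≤ 2 * n
    tourThrough u connected with Detours.spanningExtension G connected [ u ]
    ... | t , spans , ℓ≡ = t , spans , ≤-trans (m≤m+n (ℓ t) _) (≤-reflexive ℓ≡)

    module _ (T : Graph n) (T⊆G : Subgraph T G) (connected : Connected T) (acyclic : Acyclic T) where

      treePlusJoinTour : ∀ {u} (C : u ⇝ u) → (∀ y → isOdd (degree T y) ≡ true → y ∈ vertices C) →
                         Σ (u ⇝ u) λ t → Spans t × 2 * ℓ t ≤ ℓ C + 2 * n
      treePlusJoinTour {u} C visits
        with TJoin.joinFromWalk G (isOdd ∘ degree T) (OddVertices.evenlyManyOddDegrees T) C visits
           | Tree.spanningGrowth T u connected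
      ... | J , J-ends , J-short | S , g , spanning with TreeTour.treeTour G T T⊆G acyclic u g spanning J J-ends
      ... | t , spans , ℓt≡ = t , spans , (begin
        2 * ℓ t                          ≡⟨ cong (2 *_) ℓt≡ ⟩
        2 * (ℓˢ J + attachments u g)     ≡⟨ *-distribˡ-+ 2 (ℓˢ J) _ ⟩
        2 * ℓˢ J + 2 * attachments u g   ≤⟨ +-mono-≤ J-short (*-monoʳ-≤ 2 (<⇒≤ (attachments<n u g spanning))) ⟩
        ℓ C + 2 * n                      ∎)
        where
        open ≤-Reasoning
        open Segments G using (ℓˢ)
        open Tree T using (attachments; attachments<n)

module BestTour where
  open Counting using (isOdd; count)
  open Tours using (tourThrough; treePlusJoinTour)
  open RationalBounds using (ShortEnough; oneOfThreeTours)
  open import Data.Bool using (true)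
  open import Data.List.Membership.Propositional using (_∈_)
  open import Data.Sum using (_⊎_; inj₁; inj₂)
  open import Relation.Binary.PropositionalEquality using (_≡_)
  open import Defs hiding (sym)
  open import Data.Nat using (ℕ)
  open import Data.Product using (Σ; _×_; _,_)
  open import Data.Rational using (0ℚ; 1ℚ; _≤_; _<_; _+_; _*_)

  module _ {n : ℕ} (G : Graph n) (connected : Connected G)
           (T : Graph n) (T⊆G : Subgraph T G) (T-connected : Connected T) (acyclic : Acyclic T) where
    open Walks G

    shortTour : ∀ γ → 0ℚ ≤ γ → γ < toℚ 3 → ∀ {u} (W : u ⇝ u) → (∀ y → isOdd (degree T y) ≡ true → y ∈ vertices W) →
                toℚ (ℓ W) ≤ (1ℚ + γ) * toℚ (count (vertices W)) → Σ (u ⇝ u) λ t → Spans t × ShortEnough γ n (ℓ t)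
    shortTour γ 0≤γ γ<3 {u} W odd⇒∈ ℓW≤ =
      let t₁ , spans₁ , bound₁ = treePlusJoinTour G T T⊆G T-connected acyclic W odd⇒∈
          t₂ , spans₂ , bound₂ = Detours.spanningExtension G connected W
          t₃ , spans₃ , bound₃ = tourThrough G u connected
          pick : ShortEnough γ n (ℓ t₁) ⊎ ShortEnough γ n (ℓ t₂) ⊎ ShortEnough γ n (ℓ t₃) →
                 Σ (u ⇝ u) λ t → Spans t × ShortEnough γ n (ℓ t)
          pick = λ { (inj₁ short)         → t₁ , spans₁ , short
                   ; (inj₂ (inj₁ short)) → t₂ , spans₂ , short
                   ; (inj₂ (inj₂ short)) → t₃ , spans₃ , short }
      in pick (oneOfThreeTours 0≤γ γ<3 n (ℓ W) (count (vertices W)) (ℓ t₁) (ℓ t₂) (ℓ t₃) bound₁ bound₂ bound₃ ℓW≤)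

open import Defs
open import Data.Nat using (ℕ)
open import Data.Fin using (Fin)
open import Data.Product using (Σ; _×_; _,_; proj₁)
open import Data.Rational using (ℚ; 0ℚ; 1ℚ; _≤_; _<_; _+_; _*_; _-_)
open import Data.Nat as N using ()
open import Data.Bool using (true)
open import Data.List.Membership.Propositional using (_∈_)
import Relation.Binary.PropositionalEquality as ≡
open ≡ using (_≡_; subst; subst₂)
open Counting using (isOdd; isOdd⇒%2≡1; count)
open RationalBounds using (ShortEnough)
open BestTour using (shortTour)

theorem9 : ∀ {n : ℕ} (G : Graph n) → TwoVertexConnected G →
    (T : Graph n) → IsSpanningTree G T →
    (γ : ℚ) → 0ℚ ≤ γ → γ < toℚ 3 →
    (C : ClosedWalk G) → (∀ (v : Fin n) → OddDegree T v → Visits C v) →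
    toℚ (len C) ≤ (1ℚ + γ) * toℚ (numDistinct C) →
    Σ (ClosedWalk G) (λ τ → IsTSPTour τ × (toℚ (len τ) * (toℚ 3 - γ) ≤ toℚ (4 N.* n)))
theorem9 {n} G (_ , connected , _) T (T⊆G , T-connected , acyclic) γ 0≤γ γ<3 C odd⇒visited ℓC≤ =
  asTSPTour (shortTour G connected T T⊆G T-connected acyclic γ 0≤γ γ<3 walk odd⇒∈ ℓ≤)
  where
  open Walks G
  open Underlying (underlying C)
  odd⇒∈ : ∀ y → isOdd (degree T y) ≡ true → y ∈ vertices walk
  odd⇒∈ y odd = visits⇒∈ y (odd⇒visited y (isOdd⇒%2≡1 (degree T y) odd))
  ℓ≤ : toℚ (ℓ walk) ≤ (1ℚ + γ) * toℚ (count (vertices walk))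
  ℓ≤ = subst₂ (λ l k → toℚ l ≤ (1ℚ + γ) * toℚ k) len≡ℓ numDistinct≡count ℓC≤
  asTSPTour : Σ (proj₁ C ⇝ proj₁ C) (λ t → Spans t × ShortEnough γ n (ℓ t)) →
              Σ (ClosedWalk G) (λ τ → IsTSPTour τ × (toℚ (len τ) * (toℚ 3 - γ) ≤ toℚ (4 N.* n)))
  asTSPTour (t , spans , short) = toClosedWalk t , spans , subst (ShortEnough γ n) (≡.sym (len-toClosedWalk t)) short
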